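{- There is an absolute constant $\gamma_0>0$ such that the following holds. Let $X$ be a set of cardinality $n$, $m\in\{1,\dots,n\}$, $l\in\{m+1,\dots,n\}$, $\gamma$ with $\gamma_0\le\gamma\le\min\{\frac{l}{m^2},\binom{n}{l}\}$, and let $\mathcal{F}\subset\binom{X}{m}$ be weighted by $\tilde w:\mathcal{F}\times\mathcal{F}\to\mathbb{Z}_{\ge0}$ satisfying the $\Gamma_{\tilde w}\!\left(\frac{14\gamma nm}{l},h\right)$-condition for some $h\in\mathbb{R}_{>1}$. Then for each $\epsilon\in(0,1)$ there are at least $\left\lceil(1-\epsilon)\binom{n}{l}\right\rceil$ sets $Y\in\binom{X}{l}$ such that \[ \sum_{U,V\in\mathcal{F}\cap\binom{Y}{m}}\tilde w(U,V) < \frac{h\binom{l}{m}^2}{\epsilon\left(1-\frac{1}{2\gamma}\right)\binom{n}{m}^2}\sum_{U,V\in\mathcal{F}}\tilde w(U,V). \]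
   Context: $\binom{X}{m}$ is the family of $m$-subsets of $X$. For $b,h\in\mathbb{R}_{>1}$, $\mathcal{F}$ weighted by $\tilde w:\mathcal{F}\times\mathcal{F}\to\mathbb{Z}_{\ge0}$ satisfies the $\Gamma_{\tilde w}(b,h)$-condition if $\sum_{U,V\in\mathcal{F}}\tilde w(U,V)>0$ and for every $j\in\{1,\dots,m\}$, $\sum_{U,V\in\mathcal{F},|U\cap V|=j}\tilde w(U,V)\le h\,b^{ -j}\binom{m}{j}\sum_{U,V\in\mathcal{F}}\tilde w(U,V)$ (sums over ordered pairs).
   Formalization: The parameters γ, h and ε range over the rationals rather than the reals. -}

module Defs where

open import Data.Nat as ℕ using (ℕ; zero; suc)
open import Data.Nat.Combinatorics using (_C_)
open import Data.Integer as ℤ using (ℤ; +_)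
open import Data.Rational as ℚ using (ℚ; 0ℚ; 1ℚ; _+_; _*_; _-_; _≤_; _<_; _÷_; ceiling)
open import Data.Rational.Properties using (_≟_)
open import Data.Fin using (Fin)
open import Data.Fin.Subset using (Subset; _⊆_; _∩_; ∣_∣; inside; outside)
open import Data.Vec using (_∷_; [])
open import Data.List using (List; []; _∷_; map; concatMap; filter; length)
open import Data.Nat.ListAction using (sum)
open import Data.Fin.Subset.Properties using (_⊆?_)
open import Data.List.Relation.Unary.All using (All)
open import Data.List.Relation.Unary.Unique.Propositional using (Unique)
open import Data.Product using (_×_)
open import Relation.Binary.PropositionalEquality using (_≡_)
open import Relation.Nullary using (yes; no)

ℕ→ℚ : ℕ → ℚ
ℕ→ℚ k = (+ k) ℚ./ 1

-- total division on ℚ (convention: p ⊘ 0 = 0; only used with nonzero divisors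
-- in the statement, under its hypotheses)
_⊘_ : ℚ → ℚ → ℚ
p ⊘ q with q ≟ 0ℚ
... | yes _ = 0ℚ
... | no q≢0 = ℚ._÷_ p q {{ℚ.≢-nonZero q≢0}}

infixl 7 _⊘_

_^ℚ_ : ℚ → ℕ → ℚ
b ^ℚ zero = 1ℚ
b ^ℚ suc j = b * (b ^ℚ j)

allSubsets : (n : ℕ) → List (Subset n)
allSubsets zero = [] ∷ []
allSubsets (suc n) = map (outside ∷_) (allSubsets n) Data.List.++ map (inside ∷_) (allSubsets n)

subsetsOfSize : (n m : ℕ) → List (Subset n)
subsetsOfSize n m = filter (λ Y → ∣ Y ∣ ℕ.≟ m) (allSubsets n)

IsFamily : {n : ℕ} → ℕ → List (Subset n) → Set
IsFamily m F = Unique F × All (λ U → ∣ U ∣ ≡ m) F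

Weight : ℕ → Set
Weight n = Subset n → Subset n → ℕ

totalWeight : {n : ℕ} → Weight n → List (Subset n) → ℕ
totalWeight w F = sum (concatMap (λ U → map (λ V → w U V) F) F)

weightAt : {n : ℕ} → Weight n → List (Subset n) → ℕ → ℕ
weightAt w F j = sum (concatMap (λ U → map (λ V → w U V)
                       (filter (λ V → ∣ U ∩ V ∣ ℕ.≟ j) F)) F)

restrict : {n : ℕ} → List (Subset n) → Subset n → List (Subset n)
restrict F Y = filter (λ U → U ⊆? Y) F

Gamma : {n : ℕ} → (m : ℕ) → (w : Weight n) → (F : List (Subset n)) → (b h : ℚ) → Set
Gamma m w F b h =
  (1ℚ < b) × (1ℚ < h) × (0 ℕ.< totalWeight w F) ×
  ((j : ℕ) → 1 ℕ.≤ j → j ℕ.≤ m →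
     ℕ→ℚ (weightAt w F j) ≤ h * (1ℚ ⊘ (b ^ℚ j)) * ℕ→ℚ (m C j) * ℕ→ℚ (totalWeight w F))

countGood : (n l : ℕ) → Weight n → List (Subset n) → ℚ → ℕ
countGood n l w F bound =
  length (filter (λ Y → ℕ→ℚ (totalWeight w (restrict F Y)) Data.Rational.Properties.<? bound)
                 (subsetsOfSize n l))

{-# OPTIONS --safe #-}
module Submission where

-- Average over the l-subsets Y of X. A pair (U, V) of m-sets with |U ∩ V| = j lies in exactly
-- p(2m - j) of them, where p(k) = C(n - k, l - k); hence Σ_Y Σ_{U,V ⊆ Y} w(U,V) = Σ_j W_j p(2m - j),
-- with W_j the weight at intersection size j. The ratio p(k+1)/p(k) = (l - k)/(n - k) decreases in k
-- and is at least l/(2n) while 2k < l, so C(m,j) p(2m - j) C(n,m)² ≤ (2nm/l)^j C(n,l) C(l,m)² once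
-- 4m ≤ l; this is what γ₀ = 4 guarantees through γ m² ≤ l. The Γ-condition with b = 14γnm/l gives
-- W_j ≤ h b^(-j) C(m,j) W, and 2nm/(lb) ≤ 1/(2γ), so the j-th term is at most
-- h W C(n,l) C(l,m)² (2γ)^(-j) / C(n,m)². Summing the geometric series bounds the average by
-- ε times the threshold of the statement, and Markov's inequality concludes.

module Binomial where
  open import Data.Nat
  open import Data.Nat.Properties
  open import Data.Nat.Combinatorics using (_C_; nCk+nC[k+1]≡[n+1]C[k+1]; nC1≡n)
  open import Data.Nat.Combinatorics.Specification using (k>n⇒nCk≡0)
  open import Data.Nat.Tactic.RingSolver using (solve-∀)
  open import Data.Product using (_,_)
  open import Relation.Nullary using (yes; no)
  open import Relation.Binary.PropositionalEquality

  [1+n]C[1+k]≡nCk+nC[1+k] : ∀ n k → suc n C suc k ≡ n C k + n C suc k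
  [1+n]C[1+k]≡nCk+nC[1+k] n k = sym (nCk+nC[k+1]≡[n+1]C[k+1] n k)

  nCk>0 : ∀ {n k} → k ≤ n → 0 < n C k
  nCk>0 {k = zero}  _         = s≤s z≤n
  nCk>0 {suc n} {suc k} (s≤s k≤n) rewrite [1+n]C[1+k]≡nCk+nC[1+k] n k =
    ≤-trans (nCk>0 k≤n) (m≤m+n _ _)

  nC[1+k]*[1+k]≡nCk*[n∸k] : ∀ n k → (n C suc k) * suc k ≡ (n C k) * (n ∸ k)
  nC[1+k]*[1+k]≡nCk*[n∸k] zero    k       = sym (trans (cong ((0 C k) *_) (0∸n≡0 k)) (*-zeroʳ (0 C k)))
  nC[1+k]*[1+k]≡nCk*[n∸k] (suc n) zero    = trans (*-identityʳ _) (trans (nC1≡n (suc n)) (sym (*-identityˡ _)))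
  nC[1+k]*[1+k]≡nCk*[n∸k] (suc n) (suc k) = begin
    (suc n C suc (suc k)) * suc (suc k)          ≡⟨ cong (_* suc (suc k)) ([1+n]C[1+k]≡nCk+nC[1+k] n (suc k)) ⟩
    (X + Y) * suc (suc k)                        ≡⟨ expand X Y k ⟩
    X * suc k + X + Y * suc (suc k)              ≡⟨ cong₂ (λ a b → a + X + b) (nC[1+k]*[1+k]≡nCk*[n∸k] n k) (nC[1+k]*[1+k]≡nCk*[n∸k] n (suc k)) ⟩
    (n C k) * (n ∸ k) + X + X * (n ∸ suc k)      ≡⟨ +-assoc ((n C k) * (n ∸ k)) X _ ⟩
    (n C k) * (n ∸ k) + (X + X * (n ∸ suc k))    ≡⟨ cong ((n C k) * (n ∸ k) +_) X+X*[n∸1+k]≡X*[n∸k] ⟩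
    (n C k) * (n ∸ k) + X * (n ∸ k)              ≡⟨ *-distribʳ-+ (n ∸ k) (n C k) X ⟨
    (n C k + X) * (n ∸ k)                        ≡⟨ cong (_* (n ∸ k)) ([1+n]C[1+k]≡nCk+nC[1+k] n k) ⟨
    (suc n C suc k) * (n ∸ k)                    ∎
    where
    open ≡-Reasoning
    X = n C suc k
    Y = n C suc (suc k)
    expand : ∀ x y k → (x + y) * suc (suc k) ≡ x * suc k + x + y * suc (suc k)
    expand = solve-∀
    X+X*[n∸1+k]≡X*[n∸k] : X + X * (n ∸ suc k) ≡ X * (n ∸ k)
    X+X*[n∸1+k]≡X*[n∸k] with k <? n
    ... | yes k<n = trans (sym (*-suc X (n ∸ suc k))) (cong (X *_) (sym (+-∸-assoc 1 k<n)))
    ... | no  k≮n rewrite k>n⇒nCk≡0 (s≤s (≮⇒≥ k≮n)) = refl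

  [1+n]C[1+k]*[1+k]≡nCk*[1+n] : ∀ n k → (suc n C suc k) * suc k ≡ (n C k) * suc n
  [1+n]C[1+k]*[1+k]≡nCk*[1+n] n k = begin
    (suc n C suc k) * suc k                          ≡⟨ cong (_* suc k) ([1+n]C[1+k]≡nCk+nC[1+k] n k) ⟩
    (n C k + n C suc k) * suc k                      ≡⟨ *-distribʳ-+ (suc k) (n C k) (n C suc k) ⟩
    (n C k) * suc k + (n C suc k) * suc k            ≡⟨ cong ((n C k) * suc k +_) (nC[1+k]*[1+k]≡nCk*[n∸k] n k) ⟩
    (n C k) * suc k + (n C k) * (n ∸ k)              ≡⟨ *-distribˡ-+ (n C k) (suc k) (n ∸ k) ⟨
    (n C k) * suc (k + (n ∸ k))                      ≡⟨ nCk*[1+k+[n∸k]]≡nCk*[1+n] ⟩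
    (n C k) * suc n                                  ∎
    where
    open ≡-Reasoning
    nCk*[1+k+[n∸k]]≡nCk*[1+n] : (n C k) * suc (k + (n ∸ k)) ≡ (n C k) * suc n
    nCk*[1+k+[n∸k]]≡nCk*[1+n] with k ≤? n
    ... | yes k≤n = cong (λ x → (n C k) * suc x) (m+[n∸m]≡n k≤n)
    ... | no  k≰n rewrite k>n⇒nCk≡0 (≰⇒> k≰n) = refl

  nCk≤n^k : ∀ n k → n C k ≤ n ^ k
  nCk≤n^k n zero    = ≤-refl
  nCk≤n^k n (suc k) = begin
    n C suc k                ≤⟨ m≤m*n (n C suc k) (suc k) ⟩
    (n C suc k) * suc k      ≡⟨ nC[1+k]*[1+k]≡nCk*[n∸k] n k ⟩
    (n C k) * (n ∸ k)        ≤⟨ *-mono-≤ (nCk≤n^k n k) (m∸n≤m n k) ⟩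
    n ^ k * n                ≡⟨ *-comm (n ^ k) n ⟩
    n ^ suc k                ∎
    where open ≤-Reasoning

  [m*n]^k≡m^k*n^k : ∀ m n k → (m * n) ^ k ≡ m ^ k * n ^ k
  [m*n]^k≡m^k*n^k m n zero    = refl
  [m*n]^k≡m^k*n^k m n (suc k) = begin
    m * n * (m * n) ^ k          ≡⟨ cong (m * n *_) ([m*n]^k≡m^k*n^k m n k) ⟩
    m * n * (m ^ k * n ^ k)      ≡⟨ *-*-interchange m n (m ^ k) (n ^ k) ⟩
    m * m ^ k * (n * n ^ k)      ∎
    where
    open ≡-Reasoning
    *-*-interchange : ∀ a b c d → a * b * (c * d) ≡ a * c * (b * d)
    *-*-interchange = solve-∀

  [l∸s]*[n∸t]≤[l∸t]*[n∸s] : ∀ {t s l n} → t ≤ s → s ≤ l → l ≤ n →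
                            (l ∸ s) * (n ∸ t) ≤ (l ∸ t) * (n ∸ s)
  [l∸s]*[n∸t]≤[l∸t]*[n∸s] {t} t≤s s≤l l≤n
    with m≤n⇒∃[o]m+o≡n t≤s | m≤n⇒∃[o]m+o≡n s≤l | m≤n⇒∃[o]m+o≡n l≤n
  ... | e , refl | a , refl | d , refl = begin
    (t + e + a ∸ (t + e)) * (t + e + a + d ∸ t)    ≡⟨ cong₂ _*_ (m+n∸m≡n (t + e) a) (∸-cancel t (e + a + d) (+-assoc₄ t e a d)) ⟩
    a * (e + a + d)                                ≤⟨ m≤m+n (a * (e + a + d)) (e * d) ⟩
    a * (e + a + d) + e * d                        ≡⟨ cross e a d ⟩
    (e + a) * (a + d)                              ≡⟨ cong₂ _*_ (∸-cancel t (e + a) (+-assoc t e a)) (∸-cancel (t + e) (a + d) (+-assoc (t + e) a d)) ⟨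
    (t + e + a ∸ t) * (t + e + a + d ∸ (t + e))    ∎
    where
    open ≤-Reasoning
    ∸-cancel : ∀ x y {z} → z ≡ x + y → z ∸ x ≡ y
    ∸-cancel x y refl = m+n∸m≡n x y
    +-assoc₄ : ∀ t e a d → t + e + a + d ≡ t + (e + a + d)
    +-assoc₄ = solve-∀
    cross : ∀ e a d → a * (e + a + d) + e * d ≡ (e + a) * (a + d)
    cross = solve-∀

  module Containing (n l : ℕ) (l≤n : l ≤ n) where

    -- The number of l-subsets of an n-set containing a fixed k-subset (SubsetCount.supersets-count).
    containing : ℕ → ℕ
    containing k = (n ∸ k) C (l ∸ k)

    containing>0 : ∀ k → 0 < containing k
    containing>0 k = nCk>0 (∸-monoˡ-≤ k l≤n)

    containing-step : ∀ {k} → k < l → containing (suc k) * (n ∸ k) ≡ containing k * (l ∸ k)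
    containing-step {k} k<l rewrite +-∸-assoc 1 (≤-trans k<l l≤n) | +-∸-assoc 1 k<l =
      sym ([1+n]C[1+k]*[1+k]≡nCk*[1+n] (n ∸ suc k) (l ∸ suc k))

    nCl*lCm≡nCm*containing : ∀ {m} → m ≤ l → (n C l) * (l C m) ≡ (n C m) * containing m
    nCl*lCm≡nCm*containing {zero}  _   = trans (*-identityʳ _) (sym (*-identityˡ _))
    nCl*lCm≡nCm*containing {suc m} m<l = *-cancelʳ-≡ _ _ (suc m) (begin
      (n C l) * (l C suc m) * suc m                  ≡⟨ *-assoc (n C l) _ _ ⟩
      (n C l) * ((l C suc m) * suc m)                ≡⟨ cong ((n C l) *_) (nC[1+k]*[1+k]≡nCk*[n∸k] l m) ⟩
      (n C l) * ((l C m) * (l ∸ m))                  ≡⟨ *-assoc (n C l) _ _ ⟨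
      (n C l) * (l C m) * (l ∸ m)                    ≡⟨ cong (_* (l ∸ m)) (nCl*lCm≡nCm*containing (<⇒≤ m<l)) ⟩
      (n C m) * containing m * (l ∸ m)               ≡⟨ *-assoc (n C m) _ _ ⟩
      (n C m) * (containing m * (l ∸ m))             ≡⟨ cong ((n C m) *_) (containing-step m<l) ⟨
      (n C m) * (containing (suc m) * (n ∸ m))       ≡⟨ x*[y*z]≡x*z*y (n C m) _ _ ⟩
      (n C m) * (n ∸ m) * containing (suc m)         ≡⟨ cong (_* containing (suc m)) (nC[1+k]*[1+k]≡nCk*[n∸k] n m) ⟨
      (n C suc m) * suc m * containing (suc m)       ≡⟨ x*[y*z]≡x*z*y (n C suc m) _ _ ⟨
      (n C suc m) * (containing (suc m) * suc m)     ≡⟨ *-assoc (n C suc m) _ _ ⟨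
      (n C suc m) * containing (suc m) * suc m       ∎)
      where
      open ≡-Reasoning
      x*[y*z]≡x*z*y : ∀ x y z → x * (y * z) ≡ x * z * y
      x*[y*z]≡x*z*y = solve-∀

    -- The ratios containing (suc k) / containing k = (l ∸ k) / (n ∸ k) decrease in k.
    containing-submultiplicative : ∀ m i → m + i ≤ l →
                                   containing (m + i) * containing 0 ≤ containing m * containing i
    containing-submultiplicative m zero _ rewrite +-identityʳ m = ≤-refl
    containing-submultiplicative m (suc i) m+1+i≤l = *-cancelʳ-≤ _ _ Q {{Q≢0}} (begin
      containing (m + suc i) * containing 0 * Q
        ≡⟨ cong (λ k → containing k * containing 0 * Q) (+-suc m i) ⟩
      containing (suc (m + i)) * containing 0 * ((n ∸ (m + i)) * (n ∸ i))
        ≡⟨ rearrange₁ (containing (suc (m + i))) (containing 0) (n ∸ (m + i)) (n ∸ i) ⟩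
      containing (suc (m + i)) * (n ∸ (m + i)) * (n ∸ i) * containing 0
        ≡⟨ cong (λ x → x * (n ∸ i) * containing 0) (containing-step m+i<l) ⟩
      containing (m + i) * (l ∸ (m + i)) * (n ∸ i) * containing 0
        ≡⟨ rearrange₂ (containing (m + i)) (l ∸ (m + i)) (n ∸ i) (containing 0) ⟩
      containing (m + i) * containing 0 * ((l ∸ (m + i)) * (n ∸ i))
        ≤⟨ *-mono-≤ (containing-submultiplicative m i (<⇒≤ m+i<l))
                    ([l∸s]*[n∸t]≤[l∸t]*[n∸s] (m≤n+m i m) (<⇒≤ m+i<l) l≤n) ⟩
      containing m * containing i * ((l ∸ i) * (n ∸ (m + i)))
        ≡⟨ rearrange₃ (containing m) (containing i) (l ∸ i) (n ∸ (m + i)) ⟩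
      containing m * (containing i * (l ∸ i)) * (n ∸ (m + i))
        ≡⟨ cong (λ x → containing m * x * (n ∸ (m + i))) (containing-step i<l) ⟨
      containing m * (containing (suc i) * (n ∸ i)) * (n ∸ (m + i))
        ≡⟨ rearrange₄ (containing m) (containing (suc i)) (n ∸ i) (n ∸ (m + i)) ⟩
      containing m * containing (suc i) * Q  ∎)
      where
      open ≤-Reasoning
      m+i<l : m + i < l
      m+i<l = subst (_≤ l) (+-suc m i) m+1+i≤l
      i<l : i < l
      i<l = m+n≤o⇒n≤o m m+1+i≤l
      Q = (n ∸ (m + i)) * (n ∸ i)
      Q≢0 : NonZero Q
      Q≢0 = >-nonZero (*-mono-< (m<n⇒0<n∸m (≤-trans m+i<l l≤n)) (m<n⇒0<n∸m (≤-trans i<l l≤n)))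
      rearrange₁ : ∀ a b c d → a * b * (c * d) ≡ a * c * d * b
      rearrange₁ = solve-∀
      rearrange₂ : ∀ a b c d → a * b * c * d ≡ a * d * (b * c)
      rearrange₂ = solve-∀
      rearrange₃ : ∀ a b c d → a * b * (c * d) ≡ a * (b * c) * d
      rearrange₃ = solve-∀
      rearrange₄ : ∀ a b c d → a * (b * c) * d ≡ a * b * (d * c)
      rearrange₄ = solve-∀

    containing*l≤2n*containing[1+k] : ∀ {k} → k + k < l → containing k * l ≤ 2 * n * containing (suc k)
    containing*l≤2n*containing[1+k] {k} k+k<l = begin
      containing k * l                        ≤⟨ *-monoʳ-≤ (containing k) l≤2*[l∸k] ⟩
      containing k * (2 * (l ∸ k))            ≡⟨ x*[2*y]≡2*[x*y] (containing k) (l ∸ k) ⟩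
      2 * (containing k * (l ∸ k))            ≡⟨ cong (2 *_) (containing-step k<l) ⟨
      2 * (containing (suc k) * (n ∸ k))      ≤⟨ *-monoʳ-≤ 2 (*-monoʳ-≤ (containing (suc k)) (m∸n≤m n k)) ⟩
      2 * (containing (suc k) * n)            ≡⟨ 2*[x*y]≡2*y*x (containing (suc k)) n ⟩
      2 * n * containing (suc k)              ∎
      where
      open ≤-Reasoning
      k<l : k < l
      k<l = m+n≤o⇒m≤o (suc k) k+k<l
      k≤l∸k : k ≤ l ∸ k
      k≤l∸k = m+n≤o⇒m≤o∸n k (<⇒≤ k+k<l)
      l≤2*[l∸k] : l ≤ 2 * (l ∸ k)
      l≤2*[l∸k] = begin
        l                            ≡⟨ m+[n∸m]≡n (<⇒≤ k<l) ⟨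
        k + (l ∸ k)                  ≤⟨ +-monoˡ-≤ (l ∸ k) k≤l∸k ⟩
        (l ∸ k) + (l ∸ k)            ≡⟨ cong ((l ∸ k) +_) (+-identityʳ (l ∸ k)) ⟨
        2 * (l ∸ k)                  ∎
      x*[2*y]≡2*[x*y] : ∀ x y → x * (2 * y) ≡ 2 * (x * y)
      x*[2*y]≡2*[x*y] = solve-∀
      2*[x*y]≡2*y*x : ∀ x y → 2 * (x * y) ≡ 2 * y * x
      2*[x*y]≡2*y*x = solve-∀

    containing*l^j≤[2n]^j*containing[k+j] : ∀ j k → (k + j) + (k + j) ≤ l →
                                           containing k * l ^ j ≤ (2 * n) ^ j * containing (k + j)
    containing*l^j≤[2n]^j*containing[k+j] zero k _ rewrite +-identityʳ k =
      ≤-reflexive (trans (*-identityʳ _) (sym (*-identityˡ _)))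
    containing*l^j≤[2n]^j*containing[k+j] (suc j) k k+1+j≤l = begin
      containing k * (l * l ^ j)                         ≡⟨ *-assoc (containing k) l (l ^ j) ⟨
      containing k * l * l ^ j                           ≤⟨ *-monoˡ-≤ (l ^ j) (containing*l≤2n*containing[1+k] k+k<l) ⟩
      2 * n * containing (suc k) * l ^ j                 ≡⟨ *-assoc (2 * n) _ _ ⟩
      2 * n * (containing (suc k) * l ^ j)               ≤⟨ *-monoʳ-≤ (2 * n) (containing*l^j≤[2n]^j*containing[k+j] j (suc k) 1+k+j≤l) ⟩
      2 * n * ((2 * n) ^ j * containing (suc k + j))     ≡⟨ *-assoc (2 * n) _ _ ⟨
      (2 * n) ^ suc j * containing (suc k + j)           ≡⟨ cong (λ i → (2 * n) ^ suc j * containing i) (+-suc k j) ⟨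
      (2 * n) ^ suc j * containing (k + suc j)           ∎
      where
      open ≤-Reasoning
      1+k+j≤l : (suc k + j) + (suc k + j) ≤ l
      1+k+j≤l = subst (λ i → i + i ≤ l) (+-suc k j) k+1+j≤l
      k+k<l : k + k < l
      k+k<l = <-≤-trans (+-mono-<-≤ (m<m+n k z<s) (m≤m+n k (suc j))) k+1+j≤l

    containing[m+m]-bound : ∀ m → m + m ≤ l →
                            containing (m + m) * ((n C m) * (n C m)) ≤ (n C l) * ((l C m) * (l C m))
    containing[m+m]-bound m m+m≤l = *-cancelʳ-≤ _ _ (pm * pm) {{pm*pm≢0}} (begin
      containing (m + m) * (Cnm * Cnm) * (pm * pm)       ≡⟨ rearrange₁ (containing (m + m)) Cnm pm ⟩
      containing (m + m) * ((Cnm * pm) * (Cnm * pm))     ≡⟨ cong (λ x → containing (m + m) * (x * x)) (nCl*lCm≡nCm*containing m≤l) ⟨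
      containing (m + m) * ((Cnl * Clm) * (Cnl * Clm))   ≡⟨ rearrange₂ (containing (m + m)) Cnl Clm ⟩
      containing (m + m) * Cnl * (Cnl * (Clm * Clm))     ≤⟨ *-monoˡ-≤ _ (containing-submultiplicative m m m+m≤l) ⟩
      pm * pm * (Cnl * (Clm * Clm))                      ≡⟨ *-comm (pm * pm) _ ⟩
      Cnl * (Clm * Clm) * (pm * pm)                      ∎)
      where
      open ≤-Reasoning
      Cnm = n C m
      Cnl = n C l
      Clm = l C m
      pm = containing m
      m≤l : m ≤ l
      m≤l = m+n≤o⇒m≤o m m+m≤l
      pm*pm≢0 : NonZero (pm * pm)
      pm*pm≢0 = >-nonZero (*-mono-< (containing>0 m) (containing>0 m))
      rearrange₁ : ∀ x c p → x * (c * c) * (p * p) ≡ x * ((c * p) * (c * p))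
      rearrange₁ = solve-∀
      rearrange₂ : ∀ x c d → x * ((c * d) * (c * d)) ≡ x * c * (c * (d * d))
      rearrange₂ = solve-∀

    containing-pair-bound : ∀ m j → j ≤ m → (m + m) + (m + m) ≤ l →
                 (m C j) * containing (m + m ∸ j) * ((n C m) * (n C m)) * l ^ j
                   ≤ (2 * n * m) ^ j * ((n C l) * ((l C m) * (l C m)))
    containing-pair-bound m j j≤m 4m≤l = begin
      (m C j) * A * CC * l ^ j                   ≤⟨ *-monoˡ-≤ (l ^ j) (*-monoˡ-≤ CC (*-monoˡ-≤ A (nCk≤n^k m j))) ⟩
      m ^ j * A * CC * l ^ j                     ≡⟨ rearrange₁ (m ^ j) A CC (l ^ j) ⟩
      m ^ j * (A * l ^ j) * CC                   ≤⟨ *-monoˡ-≤ CC (*-monoʳ-≤ (m ^ j) A*l^j≤[2n]^j*containing[m+m]) ⟩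
      m ^ j * ((2 * n) ^ j * containing (m + m)) * CC   ≡⟨ rearrange₂ (m ^ j) ((2 * n) ^ j) (containing (m + m)) CC ⟩
      (2 * n) ^ j * m ^ j * (containing (m + m) * CC)   ≤⟨ *-monoʳ-≤ ((2 * n) ^ j * m ^ j) (containing[m+m]-bound m (m+n≤o⇒m≤o (m + m) 4m≤l)) ⟩
      (2 * n) ^ j * m ^ j * ((n C l) * ((l C m) * (l C m)))   ≡⟨ cong (_* ((n C l) * ((l C m) * (l C m)))) ([m*n]^k≡m^k*n^k (2 * n) m j) ⟨
      (2 * n * m) ^ j * ((n C l) * ((l C m) * (l C m)))       ∎
      where
      open ≤-Reasoning
      A = containing (m + m ∸ j)
      CC = (n C m) * (n C m)
      m+m∸j+j≡m+m : m + m ∸ j + j ≡ m + m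
      m+m∸j+j≡m+m = m∸n+n≡m (≤-trans j≤m (m≤m+n m m))
      A*l^j≤[2n]^j*containing[m+m] : A * l ^ j ≤ (2 * n) ^ j * containing (m + m)
      A*l^j≤[2n]^j*containing[m+m] = subst (λ i → A * l ^ j ≤ (2 * n) ^ j * containing i) m+m∸j+j≡m+m
        (containing*l^j≤[2n]^j*containing[k+j] j (m + m ∸ j) (subst (λ i → i + i ≤ l) (sym m+m∸j+j≡m+m) 4m≤l))
      rearrange₁ : ∀ a b c d → a * b * c * d ≡ a * (b * d) * c
      rearrange₁ = solve-∀
      rearrange₂ : ∀ a b c d → a * (b * c) * d ≡ b * a * (c * d)
      rearrange₂ = solve-∀

module ListSum where
  open import Function using (_∘_)
  open import Data.Bool using (true; false; if_then_else_)
  open import Data.Nat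
  open import Data.Nat.Properties
  open import Data.Nat.Tactic.RingSolver using (solve-∀)
  open import Data.Nat.ListAction using (sum)
  open import Data.Nat.ListAction.Properties using (sum-++)
  open import Data.List using (List; []; _∷_; map; filter; _++_; concatMap; length; upTo)
  open import Data.List.Properties using (map-++; map-∘; map-cong; map-cong-local; map-applyUpTo)
  open import Data.List.Relation.Unary.All as All using (All)
  open import Relation.Nullary using (Dec; does)
  open import Relation.Binary.PropositionalEquality using (_≡_; refl; sym; trans; cong; cong₂; module ≡-Reasoning)

  private variable
    A B : Set

  ∑ : List A → (A → ℕ) → ℕ
  ∑ xs f = sum (map f xs)

  syntax ∑ xs (λ x → e) = ∑[ x ∈ xs ] e

  𝟙 : {P : Set} → Dec P → ℕ
  𝟙 P? = if does P? then 1 else 0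

  ∑-++ : ∀ (xs ys : List A) f → ∑ (xs ++ ys) f ≡ ∑ xs f + ∑ ys f
  ∑-++ xs ys f = trans (cong sum (map-++ f xs ys)) (sum-++ (map f xs) (map f ys))

  ∑-map : ∀ (g : A → B) xs f → ∑ (map g xs) f ≡ ∑ xs (f ∘ g)
  ∑-map g xs f = cong sum (sym (map-∘ xs))

  ∑-cong : ∀ (xs : List A) {f g} → (∀ x → f x ≡ g x) → ∑ xs f ≡ ∑ xs g
  ∑-cong xs f≗g = cong sum (map-cong f≗g xs)

  ∑-congᴬ : ∀ {P : A → Set} {xs f g} → All P xs → (∀ {x} → P x → f x ≡ g x) → ∑ xs f ≡ ∑ xs g
  ∑-congᴬ Pxs f≗g = cong sum (map-cong-local (All.map f≗g Pxs))

  ∑-mono : ∀ (xs : List A) {f g} → (∀ x → f x ≤ g x) → ∑ xs f ≤ ∑ xs g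
  ∑-mono []       f≤g = z≤n
  ∑-mono (x ∷ xs) f≤g = +-mono-≤ (f≤g x) (∑-mono xs f≤g)

  ∑-zero : ∀ (xs : List A) → ∑[ x ∈ xs ] 0 ≡ 0
  ∑-zero []       = refl
  ∑-zero (x ∷ xs) = ∑-zero xs

  ∑-+ : ∀ (xs : List A) f g → ∑[ x ∈ xs ] (f x + g x) ≡ ∑ xs f + ∑ xs g
  ∑-+ []       f g = refl
  ∑-+ (x ∷ xs) f g = trans (cong (f x + g x +_) (∑-+ xs f g)) (+-+-interchange (f x) (g x) _ _)
    where
    +-+-interchange : ∀ a b c d → a + b + (c + d) ≡ a + c + (b + d)
    +-+-interchange = solve-∀

  ∑-*ˡ : ∀ (xs : List A) c f → ∑[ x ∈ xs ] (c * f x) ≡ c * ∑ xs f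
  ∑-*ˡ []       c f = sym (*-zeroʳ c)
  ∑-*ˡ (x ∷ xs) c f = trans (cong (c * f x +_) (∑-*ˡ xs c f)) (sym (*-distribˡ-+ c (f x) _))

  ∑-*ʳ : ∀ (xs : List A) f c → ∑[ x ∈ xs ] (f x * c) ≡ ∑ xs f * c
  ∑-*ʳ xs f c = trans (∑-cong xs (λ x → *-comm (f x) c)) (trans (∑-*ˡ xs c f) (*-comm c _))

  ∑-swap : ∀ (xs : List A) (ys : List B) (f : A → B → ℕ) → ∑[ x ∈ xs ] ∑[ y ∈ ys ] f x y ≡ ∑[ y ∈ ys ] ∑[ x ∈ xs ] f x y
  ∑-swap []       ys f = sym (∑-zero ys)
  ∑-swap (x ∷ xs) ys f = trans (cong (∑ ys (f x) +_) (∑-swap xs ys f)) (sym (∑-+ ys (f x) _))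

  ∑-filter : ∀ {P : A → Set} (P? : ∀ x → Dec (P x)) xs f →
             ∑ (filter P? xs) f ≡ ∑[ x ∈ xs ] (𝟙 (P? x) * f x)
  ∑-filter P? []       f = refl
  ∑-filter P? (x ∷ xs) f with does (P? x)
  ... | true  = cong₂ _+_ (sym (*-identityˡ (f x))) (∑-filter P? xs f)
  ... | false = ∑-filter P? xs f

  ∑-concatMap : ∀ (g : A → List ℕ) xs → sum (concatMap g xs) ≡ ∑[ x ∈ xs ] sum (g x)
  ∑-concatMap g []       = refl
  ∑-concatMap g (x ∷ xs) = trans (sum-++ (g x) (concatMap g xs)) (cong (sum (g x) +_) (∑-concatMap g xs))

  length≡∑1 : ∀ (xs : List A) → length xs ≡ ∑[ x ∈ xs ] 1
  length≡∑1 []       = refl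
  length≡∑1 (x ∷ xs) = cong suc (length≡∑1 xs)

  ∑-upTo-suc : ∀ k (f : ℕ → ℕ) → ∑[ j ∈ upTo (suc k) ] f j ≡ f 0 + ∑[ j ∈ upTo k ] f (suc j)
  ∑-upTo-suc k f = cong (λ js → f 0 + sum js)
    (trans (map-applyUpTo suc f k) (sym (map-applyUpTo (λ j → j) (f ∘ suc) k)))

  ∑-upTo-𝟙 : ∀ {i k} (f : ℕ → ℕ) → i < k → ∑[ j ∈ upTo k ] (𝟙 (i ≟ j) * f j) ≡ f i
  ∑-upTo-𝟙 {zero}  {suc k} f _ = begin
    ∑[ j ∈ upTo (suc k) ] (𝟙 (0 ≟ j) * f j)     ≡⟨ ∑-upTo-suc k (λ j → 𝟙 (0 ≟ j) * f j) ⟩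
    1 * f 0 + ∑[ j ∈ upTo k ] (0 * f (suc j))   ≡⟨ cong₂ _+_ (*-identityˡ (f 0)) (∑-zero (upTo k)) ⟩
    f 0 + 0                                     ≡⟨ +-identityʳ (f 0) ⟩
    f 0                                         ∎
    where open ≡-Reasoning
  ∑-upTo-𝟙 {suc i} {suc k} f (s≤s i<k) =
    trans (∑-upTo-suc k (λ j → 𝟙 (suc i ≟ j) * f j)) (∑-upTo-𝟙 (f ∘ suc) i<k)

module SubsetCount where
  open import Defs
  open ListSum
  open import Data.Bool using (if_then_else_)
  open import Data.Nat
  open import Data.Nat.Properties
  open import Data.Nat.Combinatorics using (_C_; nCk+nC[k+1]≡[n+1]C[k+1])
  open import Data.List using (map; length)
  open import Data.Fin.Subset using (Subset; inside; outside; _∪_; _∩_; ∣_∣; ⊥)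
  open import Data.Fin.Subset.Properties using (_⊆?_; x∈p∪q⁻; p⊆p∪q; q⊆p∪q; p⊆q⇒∣p∣≤∣q∣; ∣p∣≤n; ⊥⊆; ∣⊥∣≡0)
  open import Data.Sum using ([_,_])
  open import Data.Vec using (_∷_; [])
  open import Relation.Nullary using (yes; no; contradiction)
  open import Relation.Nullary.Decidable using (dec-true; dec-false)
  open import Relation.Binary.PropositionalEquality using (_≡_; refl; sym; trans; cong; cong₂; subst; module ≡-Reasoning)

  ∣p∪q∣+∣p∩q∣≡∣p∣+∣q∣ : ∀ {n} (p q : Subset n) → ∣ p ∪ q ∣ + ∣ p ∩ q ∣ ≡ ∣ p ∣ + ∣ q ∣
  ∣p∪q∣+∣p∩q∣≡∣p∣+∣q∣ []            []            = refl
  ∣p∪q∣+∣p∩q∣≡∣p∣+∣q∣ (outside ∷ p) (outside ∷ q) = ∣p∪q∣+∣p∩q∣≡∣p∣+∣q∣ p q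
  ∣p∪q∣+∣p∩q∣≡∣p∣+∣q∣ (outside ∷ p) (inside  ∷ q) =
    trans (cong suc (∣p∪q∣+∣p∩q∣≡∣p∣+∣q∣ p q)) (sym (+-suc ∣ p ∣ ∣ q ∣))
  ∣p∪q∣+∣p∩q∣≡∣p∣+∣q∣ (inside  ∷ p) (outside ∷ q) = cong suc (∣p∪q∣+∣p∩q∣≡∣p∣+∣q∣ p q)
  ∣p∪q∣+∣p∩q∣≡∣p∣+∣q∣ (inside  ∷ p) (inside  ∷ q) = cong suc (begin
    ∣ p ∪ q ∣ + suc ∣ p ∩ q ∣    ≡⟨ +-suc ∣ p ∪ q ∣ ∣ p ∩ q ∣ ⟩
    suc (∣ p ∪ q ∣ + ∣ p ∩ q ∣)  ≡⟨ cong suc (∣p∪q∣+∣p∩q∣≡∣p∣+∣q∣ p q) ⟩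
    suc (∣ p ∣ + ∣ q ∣)          ≡⟨ +-suc ∣ p ∣ ∣ q ∣ ⟨
    ∣ p ∣ + suc ∣ q ∣            ∎)
    where open ≡-Reasoning

  𝟙-⊆-∪ : ∀ {n} (U V Y : Subset n) → 𝟙 (U ⊆? Y) * 𝟙 (V ⊆? Y) ≡ 𝟙 (U ∪ V ⊆? Y)
  𝟙-⊆-∪ U V Y with U ⊆? Y | V ⊆? Y | U ∪ V ⊆? Y
  ... | yes _   | yes _   | yes _     = refl
  ... | no  _   | _       | no  _     = refl
  ... | yes _   | no  _   | no  _     = refl
  ... | yes U⊆Y | yes V⊆Y | no  U∪V⊈Y = contradiction (λ {x} x∈U∪V → [ U⊆Y , V⊆Y ] (x∈p∪q⁻ U V x∈U∪V)) U∪V⊈Y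
  ... | no  U⊈Y | _       | yes U∪V⊆Y = contradiction (λ {x} x∈U → U∪V⊆Y (p⊆p∪q V x∈U)) U⊈Y
  ... | yes _   | no  V⊈Y | yes U∪V⊆Y = contradiction (λ {x} x∈V → U∪V⊆Y (q⊆p∪q U V x∈V)) V⊈Y

  ∑-allSubsets : ∀ n (f : Subset (suc n) → ℕ) →
                 ∑ (allSubsets (suc n)) f ≡ ∑[ Y ∈ allSubsets n ] f (outside ∷ Y) + ∑[ Y ∈ allSubsets n ] f (inside ∷ Y)
  ∑-allSubsets n f = trans (∑-++ (map (outside ∷_) (allSubsets n)) _ f)
                           (cong₂ _+_ (∑-map (outside ∷_) (allSubsets n) f) (∑-map (inside ∷_) (allSubsets n) f))

  supersetsOfSize : ∀ n (A : Subset n) k →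
                    ∑[ Y ∈ allSubsets n ] (𝟙 (∣ Y ∣ ≟ ∣ A ∣ + k) * 𝟙 (A ⊆? Y)) ≡ (n ∸ ∣ A ∣) C k
  supersetsOfSize zero    []           zero    = refl
  supersetsOfSize zero    []           (suc k) = refl
  supersetsOfSize (suc n) (inside ∷ A) k =
    trans (∑-allSubsets n (λ Y → 𝟙 (∣ Y ∣ ≟ suc (∣ A ∣ + k)) * 𝟙 (inside ∷ A ⊆? Y)))
          (cong₂ _+_ nothingOutside (supersetsOfSize n A k))
    where
    nothingOutside : ∑[ Y ∈ allSubsets n ] (𝟙 (∣ Y ∣ ≟ suc (∣ A ∣ + k)) * 0) ≡ 0
    nothingOutside = trans (∑-cong (allSubsets n) (λ Y → *-zeroʳ (𝟙 (∣ Y ∣ ≟ suc (∣ A ∣ + k))))) (∑-zero (allSubsets n))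
  supersetsOfSize (suc n) (outside ∷ A) zero =
    trans (∑-allSubsets n (λ Y → 𝟙 (∣ Y ∣ ≟ ∣ A ∣ + 0) * 𝟙 (outside ∷ A ⊆? Y)))
          (cong₂ _+_ (supersetsOfSize n A 0) noSmallerSupersets)
    where
    tooLarge : ∀ Y → 𝟙 (suc ∣ Y ∣ ≟ ∣ A ∣ + 0) * 𝟙 (A ⊆? Y) ≡ 0
    tooLarge Y with A ⊆? Y
    ... | no  _   = *-zeroʳ (𝟙 (suc ∣ Y ∣ ≟ ∣ A ∣ + 0))
    ... | yes A⊆Y rewrite +-identityʳ ∣ A ∣ | dec-false (suc ∣ Y ∣ ≟ ∣ A ∣) (>⇒≢ (s≤s (p⊆q⇒∣p∣≤∣q∣ A⊆Y))) = refl
    noSmallerSupersets : ∑[ Y ∈ allSubsets n ] (𝟙 (suc ∣ Y ∣ ≟ ∣ A ∣ + 0) * 𝟙 (A ⊆? Y)) ≡ 0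
    noSmallerSupersets = trans (∑-cong (allSubsets n) tooLarge) (∑-zero (allSubsets n))
  supersetsOfSize (suc n) (outside ∷ A) (suc k) = begin
    ∑[ Y ∈ allSubsets (suc n) ] (𝟙 (∣ Y ∣ ≟ ∣ A ∣ + suc k) * 𝟙 (outside ∷ A ⊆? Y))
      ≡⟨ ∑-allSubsets n (λ Y → 𝟙 (∣ Y ∣ ≟ ∣ A ∣ + suc k) * 𝟙 (outside ∷ A ⊆? Y)) ⟩
    ∑[ Y ∈ allSubsets n ] (𝟙 (∣ Y ∣ ≟ ∣ A ∣ + suc k) * 𝟙 (A ⊆? Y))
      + ∑[ Y ∈ allSubsets n ] (𝟙 (suc ∣ Y ∣ ≟ ∣ A ∣ + suc k) * 𝟙 (A ⊆? Y))
      ≡⟨ cong (λ i → ∑[ Y ∈ allSubsets n ] (𝟙 (∣ Y ∣ ≟ ∣ A ∣ + suc k) * 𝟙 (A ⊆? Y))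
                     + ∑[ Y ∈ allSubsets n ] (𝟙 (suc ∣ Y ∣ ≟ i) * 𝟙 (A ⊆? Y))) (+-suc ∣ A ∣ k) ⟩
    ∑[ Y ∈ allSubsets n ] (𝟙 (∣ Y ∣ ≟ ∣ A ∣ + suc k) * 𝟙 (A ⊆? Y))
      + ∑[ Y ∈ allSubsets n ] (𝟙 (∣ Y ∣ ≟ ∣ A ∣ + k) * 𝟙 (A ⊆? Y))
      ≡⟨ cong₂ _+_ (supersetsOfSize n A (suc k)) (supersetsOfSize n A k) ⟩
    (n ∸ ∣ A ∣) C suc k + (n ∸ ∣ A ∣) C k
      ≡⟨ +-comm ((n ∸ ∣ A ∣) C suc k) _ ⟩
    (n ∸ ∣ A ∣) C k + (n ∸ ∣ A ∣) C suc k
      ≡⟨ nCk+nC[k+1]≡[n+1]C[k+1] (n ∸ ∣ A ∣) k ⟩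
    suc (n ∸ ∣ A ∣) C suc k
      ≡⟨ cong (λ i → i C suc k) (+-∸-assoc 1 (∣p∣≤n A)) ⟨
    (suc n ∸ ∣ A ∣) C suc k  ∎
    where open ≡-Reasoning

  supersets-count : ∀ {n l} (A : Subset n) → ∣ A ∣ ≤ l →
                    ∑[ Y ∈ subsetsOfSize n l ] 𝟙 (A ⊆? Y) ≡ (n ∸ ∣ A ∣) C (l ∸ ∣ A ∣)
  supersets-count {n} {l} A ∣A∣≤l = begin
    ∑[ Y ∈ subsetsOfSize n l ] 𝟙 (A ⊆? Y)
      ≡⟨ ∑-filter (λ Y → ∣ Y ∣ ≟ l) (allSubsets n) (λ Y → 𝟙 (A ⊆? Y)) ⟩
    ∑[ Y ∈ allSubsets n ] (𝟙 (∣ Y ∣ ≟ l) * 𝟙 (A ⊆? Y))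
      ≡⟨ cong (λ i → ∑[ Y ∈ allSubsets n ] (𝟙 (∣ Y ∣ ≟ i) * 𝟙 (A ⊆? Y))) (m+[n∸m]≡n ∣A∣≤l) ⟨
    ∑[ Y ∈ allSubsets n ] (𝟙 (∣ Y ∣ ≟ ∣ A ∣ + (l ∸ ∣ A ∣)) * 𝟙 (A ⊆? Y))
      ≡⟨ supersetsOfSize n A (l ∸ ∣ A ∣) ⟩
    (n ∸ ∣ A ∣) C (l ∸ ∣ A ∣)  ∎
    where open ≡-Reasoning

  length-subsetsOfSize : ∀ n l → length (subsetsOfSize n l) ≡ n C l
  length-subsetsOfSize n l = begin
    length (subsetsOfSize n l)                    ≡⟨ length≡∑1 (subsetsOfSize n l) ⟩
    ∑[ Y ∈ subsetsOfSize n l ] 1                  ≡⟨ ∑-cong (subsetsOfSize n l) (λ Y → cong (λ b → if b then 1 else 0) (dec-true (⊥ ⊆? Y) ⊥⊆)) ⟨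
    ∑[ Y ∈ subsetsOfSize n l ] 𝟙 (⊥ ⊆? Y)         ≡⟨ supersets-count (⊥ {n}) (subst (_≤ l) (sym (∣⊥∣≡0 n)) z≤n) ⟩
    (n ∸ ∣ ⊥ {n} ∣) C (l ∸ ∣ ⊥ {n} ∣)             ≡⟨ cong (λ i → (n ∸ i) C (l ∸ i)) (∣⊥∣≡0 n) ⟩
    n C l                                         ∎
    where open ≡-Reasoning

module FirstMoment where
  open import Defs
  open Binomial
  open ListSum
  open SubsetCount
  open import Data.Bool using (true; false)
  open import Data.Nat
  open import Data.Nat.Properties
  open import Data.List using (map; upTo)
  open import Data.List.Relation.Unary.All using (All)
  open import Data.Fin.Subset using (_∪_; _∩_; ∣_∣)
  open import Data.Fin.Subset.Properties using (_⊆?_; ∣p∩q∣≤∣p∣)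
  open import Relation.Nullary using (Dec; does)
  open import Relation.Binary.PropositionalEquality using (_≡_; sym; trans; cong; cong₂; subst; subst₂; module ≡-Reasoning)

  𝟙*x≤x : ∀ {P : Set} (P? : Dec P) x → 𝟙 P? * x ≤ x
  𝟙*x≤x P? x with does P?
  ... | true  = ≤-reflexive (+-identityʳ x)
  ... | false = z≤n

  module _ {n : ℕ} (w : Weight n) where

    totalWeight≡∑∑ : ∀ G → totalWeight w G ≡ ∑[ U ∈ G ] ∑[ V ∈ G ] w U V
    totalWeight≡∑∑ G = ∑-concatMap (λ U → map (w U) G) G

    weightAt≡∑∑ : ∀ G j → weightAt w G j ≡ ∑[ U ∈ G ] ∑[ V ∈ G ] (𝟙 (∣ U ∩ V ∣ ≟ j) * w U V)
    weightAt≡∑∑ G j = trans (∑-concatMap _ G) (∑-cong G (λ U → ∑-filter (λ V → ∣ U ∩ V ∣ ≟ j) G (w U)))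

    weightAt≤totalWeight : ∀ G j → weightAt w G j ≤ totalWeight w G
    weightAt≤totalWeight G j = subst₂ _≤_ (sym (weightAt≡∑∑ G j)) (sym (totalWeight≡∑∑ G))
      (∑-mono G (λ U → ∑-mono G (λ V → 𝟙*x≤x (∣ U ∩ V ∣ ≟ j) (w U V))))

    totalWeight-restrict : ∀ G Y → totalWeight w (restrict G Y) ≡ ∑[ U ∈ G ] ∑[ V ∈ G ] (𝟙 (U ∪ V ⊆? Y) * w U V)
    totalWeight-restrict G Y = begin
      totalWeight w (restrict G Y)
        ≡⟨ totalWeight≡∑∑ (restrict G Y) ⟩
      ∑[ U ∈ restrict G Y ] ∑[ V ∈ restrict G Y ] w U V
        ≡⟨ ∑-filter (_⊆? Y) G _ ⟩
      ∑[ U ∈ G ] (𝟙 (U ⊆? Y) * ∑[ V ∈ restrict G Y ] w U V)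
        ≡⟨ ∑-cong G (λ U → cong (𝟙 (U ⊆? Y) *_) (∑-filter (_⊆? Y) G (w U))) ⟩
      ∑[ U ∈ G ] (𝟙 (U ⊆? Y) * ∑[ V ∈ G ] (𝟙 (V ⊆? Y) * w U V))
        ≡⟨ ∑-cong G (λ U → ∑-*ˡ G (𝟙 (U ⊆? Y)) _) ⟨
      ∑[ U ∈ G ] ∑[ V ∈ G ] (𝟙 (U ⊆? Y) * (𝟙 (V ⊆? Y) * w U V))
        ≡⟨ ∑-cong G (λ U → ∑-cong G (λ V → trans (sym (*-assoc (𝟙 (U ⊆? Y)) _ _)) (cong (_* w U V) (𝟙-⊆-∪ U V Y)))) ⟩
      ∑[ U ∈ G ] ∑[ V ∈ G ] (𝟙 (U ∪ V ⊆? Y) * w U V)  ∎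
      where open ≡-Reasoning

    ∑∑-by-intersection : ∀ {m} G (g : ℕ → ℕ) → All (λ U → ∣ U ∣ ≡ m) G →
      ∑[ U ∈ G ] ∑[ V ∈ G ] (w U V * g ∣ U ∩ V ∣) ≡ ∑[ j ∈ upTo (suc m) ] (weightAt w G j * g j)
    ∑∑-by-intersection {m} G g sizes = begin
      ∑[ U ∈ G ] ∑[ V ∈ G ] (w U V * g ∣ U ∩ V ∣)
        ≡⟨ ∑-congᴬ sizes (λ {U} ∣U∣≡m → ∑-cong G (λ V → sym (∑-upTo-𝟙 (λ j → w U V * g j) (s≤s (∣U∩V∣≤m {U} ∣U∣≡m V))))) ⟩
      ∑[ U ∈ G ] ∑[ V ∈ G ] ∑[ j ∈ upTo (suc m) ] (𝟙 (∣ U ∩ V ∣ ≟ j) * (w U V * g j))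
        ≡⟨ ∑-cong G (λ U → ∑-swap G (upTo (suc m)) _) ⟩
      ∑[ U ∈ G ] ∑[ j ∈ upTo (suc m) ] ∑[ V ∈ G ] (𝟙 (∣ U ∩ V ∣ ≟ j) * (w U V * g j))
        ≡⟨ ∑-swap G (upTo (suc m)) _ ⟩
      ∑[ j ∈ upTo (suc m) ] ∑[ U ∈ G ] ∑[ V ∈ G ] (𝟙 (∣ U ∩ V ∣ ≟ j) * (w U V * g j))
        ≡⟨ ∑-cong (upTo (suc m)) level ⟩
      ∑[ j ∈ upTo (suc m) ] (weightAt w G j * g j)  ∎
      where
      open ≡-Reasoning
      ∣U∩V∣≤m : ∀ {U} → ∣ U ∣ ≡ m → ∀ V → ∣ U ∩ V ∣ ≤ m
      ∣U∩V∣≤m {U} ∣U∣≡m V = subst (∣ U ∩ V ∣ ≤_) ∣U∣≡m (∣p∩q∣≤∣p∣ U V)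
      level : ∀ j → ∑[ U ∈ G ] ∑[ V ∈ G ] (𝟙 (∣ U ∩ V ∣ ≟ j) * (w U V * g j)) ≡ weightAt w G j * g j
      level j = begin
        ∑[ U ∈ G ] ∑[ V ∈ G ] (𝟙 (∣ U ∩ V ∣ ≟ j) * (w U V * g j))
          ≡⟨ ∑-cong G (λ U → ∑-cong G (λ V → sym (*-assoc (𝟙 (∣ U ∩ V ∣ ≟ j)) (w U V) (g j)))) ⟩
        ∑[ U ∈ G ] ∑[ V ∈ G ] (𝟙 (∣ U ∩ V ∣ ≟ j) * w U V * g j)
          ≡⟨ ∑-cong G (λ U → ∑-*ʳ G _ (g j)) ⟩
        ∑[ U ∈ G ] (∑[ V ∈ G ] (𝟙 (∣ U ∩ V ∣ ≟ j) * w U V) * g j)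
          ≡⟨ ∑-*ʳ G _ (g j) ⟩
        ∑[ U ∈ G ] ∑[ V ∈ G ] (𝟙 (∣ U ∩ V ∣ ≟ j) * w U V) * g j
          ≡⟨ cong (_* g j) (weightAt≡∑∑ G j) ⟨
        weightAt w G j * g j  ∎

    first-moment : ∀ {m l} → m + m ≤ l → (l≤n : l ≤ n) → ∀ F → All (λ U → ∣ U ∣ ≡ m) F →
      ∑[ Y ∈ subsetsOfSize n l ] totalWeight w (restrict F Y)
        ≡ ∑[ j ∈ upTo (suc m) ] (weightAt w F j * Containing.containing n l l≤n (m + m ∸ j))
    first-moment {m} {l} m+m≤l l≤n F sizes = begin
      ∑[ Y ∈ L ] totalWeight w (restrict F Y)
        ≡⟨ ∑-cong L (totalWeight-restrict F) ⟩
      ∑[ Y ∈ L ] ∑[ U ∈ F ] ∑[ V ∈ F ] (𝟙 (U ∪ V ⊆? Y) * w U V)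
        ≡⟨ ∑-swap L F _ ⟩
      ∑[ U ∈ F ] ∑[ Y ∈ L ] ∑[ V ∈ F ] (𝟙 (U ∪ V ⊆? Y) * w U V)
        ≡⟨ ∑-cong F (λ U → ∑-swap L F _) ⟩
      ∑[ U ∈ F ] ∑[ V ∈ F ] ∑[ Y ∈ L ] (𝟙 (U ∪ V ⊆? Y) * w U V)
        ≡⟨ ∑-congᴬ sizes (λ ∣U∣≡m → ∑-congᴬ sizes (λ ∣V∣≡m → supersets-of-U∪V ∣U∣≡m ∣V∣≡m)) ⟩
      ∑[ U ∈ F ] ∑[ V ∈ F ] (w U V * containing (m + m ∸ ∣ U ∩ V ∣))
        ≡⟨ ∑∑-by-intersection F (λ j → containing (m + m ∸ j)) sizes ⟩
      ∑[ j ∈ upTo (suc m) ] (weightAt w F j * containing (m + m ∸ j))  ∎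
      where
      open ≡-Reasoning
      open Containing n l l≤n
      L = subsetsOfSize n l
      supersets-of-U∪V : ∀ {U V} → ∣ U ∣ ≡ m → ∣ V ∣ ≡ m →
             ∑[ Y ∈ L ] (𝟙 (U ∪ V ⊆? Y) * w U V) ≡ w U V * containing (m + m ∸ ∣ U ∩ V ∣)
      supersets-of-U∪V {U} {V} ∣U∣≡m ∣V∣≡m = begin
        ∑[ Y ∈ L ] (𝟙 (U ∪ V ⊆? Y) * w U V)    ≡⟨ ∑-*ʳ L _ (w U V) ⟩
        ∑[ Y ∈ L ] 𝟙 (U ∪ V ⊆? Y) * w U V      ≡⟨ cong (_* w U V) (supersets-count (U ∪ V) ∣U∪V∣≤l) ⟩
        containing ∣ U ∪ V ∣ * w U V           ≡⟨ cong (λ k → containing k * w U V) ∣U∪V∣≡m+m∸∣U∩V∣ ⟩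
        containing (m + m ∸ ∣ U ∩ V ∣) * w U V ≡⟨ *-comm _ (w U V) ⟩
        w U V * containing (m + m ∸ ∣ U ∩ V ∣) ∎
        where
        ∣U∪V∣+∣U∩V∣≡m+m : ∣ U ∪ V ∣ + ∣ U ∩ V ∣ ≡ m + m
        ∣U∪V∣+∣U∩V∣≡m+m = trans (∣p∪q∣+∣p∩q∣≡∣p∣+∣q∣ U V) (cong₂ _+_ ∣U∣≡m ∣V∣≡m)
        ∣U∪V∣≡m+m∸∣U∩V∣ : ∣ U ∪ V ∣ ≡ m + m ∸ ∣ U ∩ V ∣
        ∣U∪V∣≡m+m∸∣U∩V∣ = trans (sym (m+n∸n≡m ∣ U ∪ V ∣ ∣ U ∩ V ∣)) (cong (_∸ ∣ U ∩ V ∣) ∣U∪V∣+∣U∩V∣≡m+m)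
        ∣U∪V∣≤l : ∣ U ∪ V ∣ ≤ l
        ∣U∪V∣≤l = ≤-trans (m+n≤o⇒m≤o ∣ U ∪ V ∣ (≤-reflexive ∣U∪V∣+∣U∩V∣≡m+m)) m+m≤l

module RationalArithmetic where
  open import Defs
  open import Data.Nat as ℕ using (ℕ; zero; suc)
  open import Data.Nat.Coprimality using (1-coprimeTo; sym)
  open import Data.Integer as ℤ using (+_)
  import Data.Integer.Properties as ℤ
  open import Data.Integer.Tactic.RingSolver using (solve-∀)
  open import Data.Integer.DivMod using (_/_; _%_; a≡a%n+[a/n]*n; n%d<d)
  open import Data.Rational as ℚ using (ℚ; mkℚ; ↥_; ↧_; -_; 1/_; positive; nonNegative; 0ℚ; 1ℚ; _+_; _*_; _-_; _≤_; _<_; toℚᵘ; ceiling)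
  open import Data.Rational.Properties
  import Data.Rational.Unnormalised as ℚᵘ
  import Data.Rational.Unnormalised.Properties as ℚᵘ
  open import Data.Rational.Solver using (module +-*-Solver)
  open +-*-Solver using (solve; _:*_; _:=_)
  open import Relation.Nullary using (yes; no; contradiction)
  open import Relation.Binary.PropositionalEquality using (_≡_; _≢_; refl; trans; cong; subst; subst₂; module ≡-Reasoning)
    renaming (sym to ≡-sym)


  ℕ→ℚ≡mkℚ : ∀ k → ℕ→ℚ k ≡ mkℚ (+ k) 0 (sym (1-coprimeTo k))
  ℕ→ℚ≡mkℚ k = normalize-coprime (sym (1-coprimeTo k))

  toℚᵘ-ℕ→ℚ : ∀ k → toℚᵘ (ℕ→ℚ k) ≡ ℚᵘ.mkℚᵘ (+ k) 0
  toℚᵘ-ℕ→ℚ k = cong toℚᵘ (ℕ→ℚ≡mkℚ k)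

  ℕ→ℚ-+ : ∀ a b → ℕ→ℚ (a ℕ.+ b) ≡ ℕ→ℚ a + ℕ→ℚ b
  ℕ→ℚ-+ a b = toℚᵘ-injective (ℚᵘ.≃-trans lhs (ℚᵘ.≃-sym (toℚᵘ-homo-+ (ℕ→ℚ a) (ℕ→ℚ b))))
    where
    lhs : toℚᵘ (ℕ→ℚ (a ℕ.+ b)) ℚᵘ.≃ toℚᵘ (ℕ→ℚ a) ℚᵘ.+ toℚᵘ (ℕ→ℚ b)
    lhs rewrite toℚᵘ-ℕ→ℚ (a ℕ.+ b) | toℚᵘ-ℕ→ℚ a | toℚᵘ-ℕ→ℚ b =
      ℚᵘ.*≡* (trans (cong (ℤ._* + 1) (ℤ.pos-+ a b)) (over1 (+ a) (+ b)))
      where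
      over1 : ∀ x y → (x ℤ.+ y) ℤ.* + 1 ≡ (x ℤ.* + 1 ℤ.+ y ℤ.* + 1) ℤ.* + 1
      over1 = solve-∀

  ℕ→ℚ-suc : ∀ k → ℕ→ℚ (suc k) ≡ 1ℚ + ℕ→ℚ k
  ℕ→ℚ-suc k = ℕ→ℚ-+ 1 k

  ℕ→ℚ-* : ∀ a b → ℕ→ℚ (a ℕ.* b) ≡ ℕ→ℚ a * ℕ→ℚ b
  ℕ→ℚ-* a b = toℚᵘ-injective (ℚᵘ.≃-trans lhs (ℚᵘ.≃-sym (toℚᵘ-homo-* (ℕ→ℚ a) (ℕ→ℚ b))))
    where
    lhs : toℚᵘ (ℕ→ℚ (a ℕ.* b)) ℚᵘ.≃ toℚᵘ (ℕ→ℚ a) ℚᵘ.* toℚᵘ (ℕ→ℚ b)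
    lhs rewrite toℚᵘ-ℕ→ℚ (a ℕ.* b) | toℚᵘ-ℕ→ℚ a | toℚᵘ-ℕ→ℚ b =
      ℚᵘ.*≡* (cong (ℤ._* + 1) (ℤ.pos-* a b))

  ℕ→ℚ-^ : ∀ a j → ℕ→ℚ (a ℕ.^ j) ≡ ℕ→ℚ a ^ℚ j
  ℕ→ℚ-^ a zero    = refl
  ℕ→ℚ-^ a (suc j) = trans (ℕ→ℚ-* a (a ℕ.^ j)) (cong (ℕ→ℚ a *_) (ℕ→ℚ-^ a j))

  ℕ→ℚ-mono-≤ : ∀ {a b} → a ℕ.≤ b → ℕ→ℚ a ≤ ℕ→ℚ b
  ℕ→ℚ-mono-≤ {a} {b} a≤b = toℚᵘ-cancel-≤ (subst₂ ℚᵘ._≤_ (≡-sym (toℚᵘ-ℕ→ℚ a)) (≡-sym (toℚᵘ-ℕ→ℚ b))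
    (ℚᵘ.*≤* (subst₂ ℤ._≤_ (≡-sym (ℤ.*-identityʳ (+ a))) (≡-sym (ℤ.*-identityʳ (+ b))) (ℤ.+≤+ a≤b))))

  ℕ→ℚ-cancel-≤ : ∀ {a b} → ℕ→ℚ a ≤ ℕ→ℚ b → a ℕ.≤ b
  ℕ→ℚ-cancel-≤ {a} {b} ⟦a⟧≤⟦b⟧ with subst₂ ℚᵘ._≤_ (toℚᵘ-ℕ→ℚ a) (toℚᵘ-ℕ→ℚ b) (toℚᵘ-mono-≤ ⟦a⟧≤⟦b⟧)
  ... | ℚᵘ.*≤* a*1≤b*1 = ℤ.drop‿+≤+ (subst₂ ℤ._≤_ (ℤ.*-identityʳ (+ a)) (ℤ.*-identityʳ (+ b)) a*1≤b*1)

  ℕ→ℚ-mono-< : ∀ {a b} → a ℕ.< b → ℕ→ℚ a < ℕ→ℚ b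
  ℕ→ℚ-mono-< {a} {b} a<b = toℚᵘ-cancel-< (subst₂ ℚᵘ._<_ (≡-sym (toℚᵘ-ℕ→ℚ a)) (≡-sym (toℚᵘ-ℕ→ℚ b))
    (ℚᵘ.*<* (subst₂ ℤ._<_ (≡-sym (ℤ.*-identityʳ (+ a))) (≡-sym (ℤ.*-identityʳ (+ b))) (ℤ.+<+ a<b))))

  0≤ℕ→ℚ : ∀ k → 0ℚ ≤ ℕ→ℚ k
  0≤ℕ→ℚ k = ℕ→ℚ-mono-≤ {0} {k} ℕ.z≤n

  ℕ→ℚ>0 : ∀ {k} → 1 ℕ.≤ k → 0ℚ < ℕ→ℚ k
  ℕ→ℚ>0 = ℕ→ℚ-mono-< {0}

  i*d≤j⇒i≤j/d : ∀ {i j} d .{{_ : ℕ.NonZero d}} → i ℤ.* + d ℤ.≤ j → i ℤ.≤ j / + d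
  i*d≤j⇒i≤j/d {i} {j} d i*d≤j =
    subst (i ℤ.≤_) (ℤ.pred-suc (j / + d)) (ℤ.i<j⇒i≤pred[j] (ℤ.*-cancelʳ-<-nonNeg {i} {ℤ.suc (j / + d)} (+ d) i*d<[1+j/d]*d))
    where
    open ℤ.≤-Reasoning
    i*d<[1+j/d]*d : i ℤ.* + d ℤ.< ℤ.suc (j / + d) ℤ.* + d
    i*d<[1+j/d]*d = begin-strict
      i ℤ.* + d                            ≤⟨ i*d≤j ⟩
      j                                    ≡⟨ a≡a%n+[a/n]*n j (+ d) ⟩
      + (j % + d) ℤ.+ (j / + d) ℤ.* + d    <⟨ ℤ.+-monoˡ-< ((j / + d) ℤ.* + d) (ℤ.+<+ (n%d<d j (+ d))) ⟩
      + d ℤ.+ (j / + d) ℤ.* + d            ≡⟨ distrib (j / + d) (+ d) ⟩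
      ℤ.suc (j / + d) ℤ.* + d             ∎
      where
      distrib : ∀ x y → y ℤ.+ x ℤ.* y ≡ (ℤ.1ℤ ℤ.+ x) ℤ.* y
      distrib = solve-∀

  ceiling≡-[-↥/↧] : ∀ q → ceiling q ≡ ℤ.- ((ℤ.- ↥ q) / ↧ q)
  ceiling≡-[-↥/↧] (mkℚ ℤ.-[1+ _ ] _ _) = refl
  ceiling≡-[-↥/↧] (mkℚ ℤ.+0       _ _) = refl
  ceiling≡-[-↥/↧] (mkℚ ℤ.+[1+ _ ] _ _) = refl

  ceiling≤ : ∀ q k → q ≤ ℕ→ℚ k → ceiling q ℤ.≤ + k
  ceiling≤ q k q≤k = begin
    ceiling q                                ≡⟨ ceiling≡-[-↥/↧] q ⟩
    ℤ.- ((ℤ.- ↥ q) / ↧ q)                    ≤⟨ ℤ.neg-mono-≤ (i*d≤j⇒i≤j/d (ℚ.↧ₙ q) -k*d≤-a) ⟩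
    ℤ.- (ℤ.- + k)                            ≡⟨ ℤ.neg-involutive (+ k) ⟩
    + k                                      ∎
    where
    open ℤ.≤-Reasoning
    a*1≤k*d : ↥ q ℤ.* + 1 ℤ.≤ + k ℤ.* ↧ q
    a*1≤k*d = drop-*≤* (subst (q ≤_) (ℕ→ℚ≡mkℚ k) q≤k)
    -k*d≤-a : ℤ.- + k ℤ.* ↧ q ℤ.≤ ℤ.- ↥ q
    -k*d≤-a = subst₂ ℤ._≤_ (ℤ.neg-distribˡ-* (+ k) (↧ q)) (cong ℤ.-_ (ℤ.*-identityʳ (↥ q))) (ℤ.neg-mono-≤ a*1≤k*d)

  q>0⇒q≢0 : ∀ {q} → 0ℚ < q → q ≢ 0ℚ
  q>0⇒q≢0 q>0 q≡0 = <⇒≢ q>0 (≡-sym q≡0)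

  p*q≥0 : ∀ {p q} → 0ℚ ≤ p → 0ℚ ≤ q → 0ℚ ≤ p * q
  p*q≥0 {p} {q} p≥0 q≥0 = nonNegative⁻¹ (p * q) {{nonNeg*nonNeg⇒nonNeg p {{nonNegative p≥0}} q {{nonNegative q≥0}}}}

  p*q>0 : ∀ {p q} → 0ℚ < p → 0ℚ < q → 0ℚ < p * q
  p*q>0 {p} {q} p>0 q>0 = positive⁻¹ (p * q) {{pos*pos⇒pos p {{positive p>0}} q {{positive q>0}}}}

  [p⊘q]*q≡p : ∀ p q → q ≢ 0ℚ → p ⊘ q * q ≡ p
  [p⊘q]*q≡p p q q≢0 with q ≟ 0ℚ
  ... | yes q≡0 = contradiction q≡0 q≢0
  ... | no  q≢0 = begin
    p * (1/ q) * q     ≡⟨ *-assoc p (1/ q) q ⟩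
    p * (1/ q * q)     ≡⟨ cong (p *_) (*-inverseˡ q) ⟩
    p * 1ℚ             ≡⟨ *-identityʳ p ⟩
    p                  ∎
    where
    open ≡-Reasoning
    instance _ = ℚ.≢-nonZero q≢0

  p⊘q>0 : ∀ {p q} → 0ℚ < p → 0ℚ < q → 0ℚ < p ⊘ q
  p⊘q>0 {p} {q} p>0 q>0 with q ≟ 0ℚ
  ... | yes q≡0 = contradiction q≡0 (q>0⇒q≢0 q>0)
  ... | no  q≢0 = positive⁻¹ (p * (1/ q) {{pos⇒nonZero q}}) {{pos*pos⇒pos p _ {{1/pos⇒pos q}}}}
    where
    instance
      _ = positive p>0
      _ = positive q>0

  ^ℚ-distrib-* : ∀ a b j → (a * b) ^ℚ j ≡ a ^ℚ j * b ^ℚ j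
  ^ℚ-distrib-* a b zero    = ≡-sym (*-identityˡ 1ℚ)
  ^ℚ-distrib-* a b (suc j) = trans (cong (a * b *_) (^ℚ-distrib-* a b j)) (interchange a b (a ^ℚ j) (b ^ℚ j))
    where
    interchange : ∀ a b c d → a * b * (c * d) ≡ a * c * (b * d)
    interchange = solve 4 (λ a b c d → a :* b :* (c :* d) := a :* c :* (b :* d)) refl

  ^ℚ>0 : ∀ {a} j → 0ℚ < a → 0ℚ < a ^ℚ j
  ^ℚ>0 zero    _   = positive⁻¹ 1ℚ
  ^ℚ>0 (suc j) a>0 = p*q>0 a>0 (^ℚ>0 j a>0)

  ^ℚ≥0 : ∀ {a} j → 0ℚ ≤ a → 0ℚ ≤ a ^ℚ j
  ^ℚ≥0 zero    _   = nonNegative⁻¹ 1ℚ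
  ^ℚ≥0 (suc j) a≥0 = p*q≥0 a≥0 (^ℚ≥0 j a≥0)

  p≤q⇒0≤q-p : ∀ {p q} → p ≤ q → 0ℚ ≤ q - p
  p≤q⇒0≤q-p {p} {q} p≤q = subst (_≤ q - p) (+-inverseʳ p) (+-monoˡ-≤ (- p) p≤q)

  p<q⇒0<q-p : ∀ {p q} → p < q → 0ℚ < q - p
  p<q⇒0<q-p {p} {q} p<q = subst (_< q - p) (+-inverseʳ p) (+-monoˡ-< (- p) p<q)

  p-q≤p : ∀ p {q} → 0ℚ ≤ q → p - q ≤ p
  p-q≤p p q≥0 = subst (p - _ ≤_) (+-identityʳ p) (+-monoʳ-≤ p (neg-antimono-≤ q≥0))

module Averaging where
  open import Defs
  open ListSum using (∑; ∑-upTo-suc)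
  open RationalArithmetic
  open import Function using (_∘_)
  open import Data.Nat as ℕ using (ℕ; zero; suc)
  import Data.Nat.Properties as ℕ
  open import Data.Rational as ℚ using (ℚ; -_; positive; nonNegative; 0ℚ; 1ℚ; _+_; _*_; _-_; _≤_; _<_)
  open import Data.Rational.Properties
  open import Data.Rational.Solver using (module +-*-Solver)
  open +-*-Solver using (solve; _:+_; _:-_; _:*_; _:=_; con)
  open import Data.List using (List; []; _∷_; filter; length; upTo)
  open import Data.List.Properties using (filter-accept; filter-reject)
  open import Relation.Nullary using (Dec; yes; no)
  open import Relation.Binary.PropositionalEquality using (_≡_; refl; cong; subst)
    renaming (sym to ≡-sym)

  geometric-bound : ∀ k (f : ℕ → ℕ) {K y} → y ≤ 1ℚ → (∀ j → j ℕ.< k → ℕ→ℚ (f j) ≤ K * y ^ℚ j) →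
                    ℕ→ℚ (∑ (upTo k) f) * (1ℚ - y) ≤ K * (1ℚ - y ^ℚ k)
  geometric-bound zero    f {K} {y} _ _ = ≤-reflexive (begin-equality
    0ℚ * (1ℚ - y)      ≡⟨ *-zeroˡ (1ℚ - y) ⟩
    0ℚ                 ≡⟨ *-zeroʳ K ⟨
    K * 0ℚ             ≡⟨ cong (K *_) (+-inverseʳ 1ℚ) ⟨
    K * (1ℚ - 1ℚ)      ∎)
    where open ≤-Reasoning
  geometric-bound (suc k) f {K} {y} y≤1 f≤Ky^j = begin
    ℕ→ℚ (∑ (upTo (suc k)) f) * (1ℚ - y)
      ≡⟨ cong (λ s → ℕ→ℚ s * (1ℚ - y)) (∑-upTo-suc k f) ⟩
    ℕ→ℚ (f 0 ℕ.+ ∑ (upTo k) (f ∘ suc)) * (1ℚ - y)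
      ≡⟨ cong (_* (1ℚ - y)) (ℕ→ℚ-+ (f 0) _) ⟩
    (ℕ→ℚ (f 0) + ℕ→ℚ (∑ (upTo k) (f ∘ suc))) * (1ℚ - y)
      ≡⟨ *-distribʳ-+ (1ℚ - y) (ℕ→ℚ (f 0)) _ ⟩
    ℕ→ℚ (f 0) * (1ℚ - y) + ℕ→ℚ (∑ (upTo k) (f ∘ suc)) * (1ℚ - y)
      ≤⟨ +-mono-≤ (*-monoʳ-≤-nonNeg (1ℚ - y) {{nonNegative 1-y≥0}} (f≤Ky^j 0 ℕ.z<s))
                  (geometric-bound k (f ∘ suc) {K * y} y≤1 tail≤Ky*y^j) ⟩
    K * 1ℚ * (1ℚ - y) + K * y * (1ℚ - y ^ℚ k)
      ≡⟨ telescope K y (y ^ℚ k) ⟩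
    K * (1ℚ - y * y ^ℚ k)  ∎
    where
    open ≤-Reasoning
    1-y≥0 : 0ℚ ≤ 1ℚ - y
    1-y≥0 = p≤q⇒0≤q-p y≤1
    tail≤Ky*y^j : ∀ j → j ℕ.< k → ℕ→ℚ (f (suc j)) ≤ K * y * y ^ℚ j
    tail≤Ky*y^j j j<k = subst (ℕ→ℚ (f (suc j)) ≤_) (≡-sym (*-assoc K y (y ^ℚ j))) (f≤Ky^j (suc j) (ℕ.s≤s j<k))
    telescope : ∀ K y t → K * 1ℚ * (1ℚ - y) + K * y * (1ℚ - t) ≡ K * (1ℚ - y * t)
    telescope = solve 3 (λ K y t → K :* con 1ℚ :* (con 1ℚ :- y) :+ K :* y :* (con 1ℚ :- t) := K :* (con 1ℚ :- y :* t)) refl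

  module _ {A : Set} (f : A → ℕ) (B : ℚ) where

    below : List A → List A
    below = filter (λ x → ℕ→ℚ (f x) <? B)

    length*B≤length-below*B+∑ : ∀ xs → ℕ→ℚ (length xs) * B ≤ ℕ→ℚ (length (below xs)) * B + ℕ→ℚ (∑ xs f)
    length*B≤length-below*B+∑ [] = ≤-reflexive (≡-sym (+-identityʳ (0ℚ * B)))
    length*B≤length-below*B+∑ (x ∷ xs) = split (ℕ→ℚ (f x) <? B)
      where
      open ≤-Reasoning
      N = length xs
      G = length (below xs)
      S = ∑ xs f
      -- Splitting on an argument rather than with `with`: abstracting the comparison in the goal
      -- makes Agda normalise the ℕ→ℚ casts there, which is prohibitively slow.
      split : Dec (ℕ→ℚ (f x) < B) →
              ℕ→ℚ (suc N) * B ≤ ℕ→ℚ (length (below (x ∷ xs))) * B + ℕ→ℚ (f x ℕ.+ S)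
      split (yes fx<B) = subst (λ ys → ℕ→ℚ (suc N) * B ≤ ℕ→ℚ (length ys) * B + ℕ→ℚ (f x ℕ.+ S))
                               (≡-sym (filter-accept (λ x → ℕ→ℚ (f x) <? B) fx<B)) (begin
        ℕ→ℚ (suc N) * B                          ≡⟨ cong (_* B) (ℕ→ℚ-suc N) ⟩
        (1ℚ + ℕ→ℚ N) * B                         ≡⟨ *-distribʳ-+ B 1ℚ (ℕ→ℚ N) ⟩
        1ℚ * B + ℕ→ℚ N * B                       ≤⟨ +-monoʳ-≤ (1ℚ * B) (length*B≤length-below*B+∑ xs) ⟩
        1ℚ * B + (ℕ→ℚ G * B + ℕ→ℚ S)             ≤⟨ +-monoʳ-≤ (1ℚ * B) (+-monoʳ-≤ (ℕ→ℚ G * B) (ℕ→ℚ-mono-≤ (ℕ.m≤n+m S (f x)))) ⟩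
        1ℚ * B + (ℕ→ℚ G * B + ℕ→ℚ (f x ℕ.+ S))   ≡⟨ +-assoc (1ℚ * B) _ _ ⟨
        1ℚ * B + ℕ→ℚ G * B + ℕ→ℚ (f x ℕ.+ S)     ≡⟨ cong (_+ ℕ→ℚ (f x ℕ.+ S)) (*-distribʳ-+ B 1ℚ (ℕ→ℚ G)) ⟨
        (1ℚ + ℕ→ℚ G) * B + ℕ→ℚ (f x ℕ.+ S)       ≡⟨ cong (λ g → g * B + ℕ→ℚ (f x ℕ.+ S)) (ℕ→ℚ-suc G) ⟨
        ℕ→ℚ (suc G) * B + ℕ→ℚ (f x ℕ.+ S)        ∎)
      split (no B≤fx) = subst (λ ys → ℕ→ℚ (suc N) * B ≤ ℕ→ℚ (length ys) * B + ℕ→ℚ (f x ℕ.+ S))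
                              (≡-sym (filter-reject (λ x → ℕ→ℚ (f x) <? B) B≤fx)) (begin
        ℕ→ℚ (suc N) * B                  ≡⟨ cong (_* B) (ℕ→ℚ-suc N) ⟩
        (1ℚ + ℕ→ℚ N) * B                 ≡⟨ *-distribʳ-+ B 1ℚ (ℕ→ℚ N) ⟩
        1ℚ * B + ℕ→ℚ N * B               ≤⟨ +-mono-≤ (≤-reflexive (*-identityˡ B)) (length*B≤length-below*B+∑ xs) ⟩
        B + (ℕ→ℚ G * B + ℕ→ℚ S)          ≤⟨ +-monoˡ-≤ (ℕ→ℚ G * B + ℕ→ℚ S) (≮⇒≥ B≤fx) ⟩
        ℕ→ℚ (f x) + (ℕ→ℚ G * B + ℕ→ℚ S)  ≡⟨ swap (ℕ→ℚ (f x)) (ℕ→ℚ G * B) (ℕ→ℚ S) ⟩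
        ℕ→ℚ G * B + (ℕ→ℚ (f x) + ℕ→ℚ S)  ≡⟨ cong (λ s → ℕ→ℚ G * B + s) (ℕ→ℚ-+ (f x) S) ⟨
        ℕ→ℚ G * B + ℕ→ℚ (f x ℕ.+ S)      ∎)
        where
        swap : ∀ a b c → a + (b + c) ≡ b + (a + c)
        swap = solve 3 (λ a b c → a :+ (b :+ c) := b :+ (a :+ c)) refl

    markov : ∀ {ε} xs → 0ℚ < B → ℕ→ℚ (∑ xs f) ≤ ε * ℕ→ℚ (length xs) * B →
             (1ℚ - ε) * ℕ→ℚ (length xs) ≤ ℕ→ℚ (length (below xs))
    markov {ε} xs B>0 ∑≤εNB = *-cancelʳ-≤-pos B {{positive B>0}} (begin
      (1ℚ - ε) * N * B               ≡⟨ expand ε N B ⟩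
      N * B - ε * N * B              ≤⟨ +-monoˡ-≤ (- (ε * N * B)) (length*B≤length-below*B+∑ xs) ⟩
      G * B + ℕ→ℚ (∑ xs f) - ε * N * B   ≤⟨ +-monoˡ-≤ (- (ε * N * B)) (+-monoʳ-≤ (G * B) ∑≤εNB) ⟩
      G * B + ε * N * B - ε * N * B  ≡⟨ cancel (G * B) (ε * N * B) ⟩
      G * B                          ∎)
      where
      open ≤-Reasoning
      N = ℕ→ℚ (length xs)
      G = ℕ→ℚ (length (below xs))
      expand : ∀ e n b → (1ℚ - e) * n * b ≡ n * b - e * n * b
      expand = solve 3 (λ e n b → (con 1ℚ :- e) :* n :* b := n :* b :- e :* n :* b) refl
      cancel : ∀ a b → a + b - b ≡ a
      cancel = solve 2 (λ a b → a :+ b :- b := a) refl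

module Estimate where
  open import Defs
  open Binomial
  open ListSum
  open SubsetCount
  open FirstMoment
  open RationalArithmetic
  open Averaging
  open import Data.Nat as ℕ using (ℕ; zero; suc; _∸_)
  import Data.Nat.Properties as ℕ
  open import Data.Nat.Tactic.RingSolver using (solve-∀)
  open import Data.Nat.Combinatorics using (_C_)
  open import Data.Rational as ℚ using (ℚ; 0ℚ; 1ℚ; _+_; _*_; _-_; _≤_; _<_; positive; nonNegative)
  open import Data.Rational.Properties
  open import Data.Rational.Solver using (module +-*-Solver)
  open +-*-Solver using (solve; _:*_; _:=_)
  open import Data.Product using (_,_; proj₁; proj₂)
  open import Data.List using (List; length; upTo)
  open import Data.List.Relation.Unary.All using (All)
  open import Data.Fin.Subset using (Subset; ∣_∣)
  open import Relation.Binary.PropositionalEquality using (_≡_; refl; trans; cong; subst; subst₂; module ≡-Reasoning)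
    renaming (sym to ≡-sym)

  γ-bounds⇒4m≤l : ∀ {m l γ} → 1 ℕ.≤ m → ℕ→ℚ 4 ≤ γ → γ ≤ ℕ→ℚ l ⊘ ℕ→ℚ (m ℕ.* m) → (m ℕ.+ m) ℕ.+ (m ℕ.+ m) ℕ.≤ l
  γ-bounds⇒4m≤l {m} {l} {γ} 1≤m 4≤γ γ≤l/m² = ℕ.≤-trans 4m≤4m² (ℕ→ℚ-cancel-≤ 4m²≤l)
    where
    m²>0 : 0ℚ < ℕ→ℚ (m ℕ.* m)
    m²>0 = ℕ→ℚ-mono-< {0} (ℕ.*-mono-≤ 1≤m 1≤m)
    4m²≤l : ℕ→ℚ (4 ℕ.* (m ℕ.* m)) ≤ ℕ→ℚ l
    4m²≤l = begin
      ℕ→ℚ (4 ℕ.* (m ℕ.* m))                    ≡⟨ ℕ→ℚ-* 4 (m ℕ.* m) ⟩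
      ℕ→ℚ 4 * ℕ→ℚ (m ℕ.* m)                    ≤⟨ *-monoʳ-≤-nonNeg (ℕ→ℚ (m ℕ.* m)) {{nonNegative (<⇒≤ m²>0)}} (≤-trans 4≤γ γ≤l/m²) ⟩
      ℕ→ℚ l ⊘ ℕ→ℚ (m ℕ.* m) * ℕ→ℚ (m ℕ.* m)    ≡⟨ [p⊘q]*q≡p (ℕ→ℚ l) (ℕ→ℚ (m ℕ.* m)) (q>0⇒q≢0 m²>0) ⟩
      ℕ→ℚ l                                    ∎
      where open ≤-Reasoning
    4m≤4m² : (m ℕ.+ m) ℕ.+ (m ℕ.+ m) ℕ.≤ 4 ℕ.* (m ℕ.* m)
    4m≤4m² = ℕ.≤-trans (ℕ.≤-reflexive (four m)) (ℕ.*-monoʳ-≤ 4 (ℕ.m≤m*n m m {{ℕ.>-nonZero 1≤m}}))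
      where
      four : ∀ m → (m ℕ.+ m) ℕ.+ (m ℕ.+ m) ≡ 4 ℕ.* m
      four = solve-∀

  weightAt-bound : ∀ {n m} {w : Weight n} {F b h} → Gamma m w F b h → ∀ j → j ℕ.≤ m →
    ℕ→ℚ (weightAt w F j) ≤ h * (1ℚ ⊘ b ^ℚ j) * ℕ→ℚ (m C j) * ℕ→ℚ (totalWeight w F)
  weightAt-bound (_ , _ , _ , Γ) (suc j) 1+j≤m = Γ (suc j) (ℕ.s≤s ℕ.z≤n) 1+j≤m
  weightAt-bound {w = w} {F} {h = h} (_ , 1<h , _ , _) zero _ = begin
    ℕ→ℚ (weightAt w F 0)          ≤⟨ ℕ→ℚ-mono-≤ (weightAt≤totalWeight w F 0) ⟩
    W                             ≡⟨ *-identityˡ W ⟨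
    1ℚ * W                        ≤⟨ *-monoʳ-≤-nonNeg W {{nonNegative (0≤ℕ→ℚ (totalWeight w F))}} (<⇒≤ 1<h) ⟩
    h * W                         ≡⟨ cong (_* W) (trans (*-identityʳ (h * 1ℚ)) (*-identityʳ h)) ⟨
    h * 1ℚ * 1ℚ * W               ∎
    where
    open ≤-Reasoning
    W = ℕ→ℚ (totalWeight w F)

  module Bound {n m l : ℕ} {γ h ε : ℚ} {F : List (Subset n)} {w : Weight n}
    (1≤m : 1 ℕ.≤ m) (l≤n : l ℕ.≤ n)
    (4≤γ : ℕ→ℚ 4 ≤ γ) (γ≤l/m² : γ ≤ ℕ→ℚ l ⊘ ℕ→ℚ (m ℕ.* m))
    (sizes : All (λ U → ∣ U ∣ ≡ m) F)
    (Γ : Gamma m w F ((ℕ→ℚ 14 * γ * ℕ→ℚ n * ℕ→ℚ m) ⊘ ℕ→ℚ l) h)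
    (ε>0 : 0ℚ < ε)
    where

    open Containing n l l≤n

    b z W K : ℚ
    b = (ℕ→ℚ 14 * γ * ℕ→ℚ n * ℕ→ℚ m) ⊘ ℕ→ℚ l
    z = 1ℚ ⊘ (ℕ→ℚ 2 * γ)
    W = ℕ→ℚ (totalWeight w F)
    K = ℕ→ℚ ((n C l) ℕ.* ((l C m) ℕ.* (l C m)))

    CC : ℕ
    CC = (n C m) ℕ.* (n C m)

    4m≤l : (m ℕ.+ m) ℕ.+ (m ℕ.+ m) ℕ.≤ l
    4m≤l = γ-bounds⇒4m≤l 1≤m 4≤γ γ≤l/m²

    m≤l : m ℕ.≤ l
    m≤l = ℕ.≤-trans (ℕ.m≤m+n m m) (ℕ.≤-trans (ℕ.m≤m+n (m ℕ.+ m) (m ℕ.+ m)) 4m≤l)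

    h>0 : 0ℚ < h
    h>0 = <-trans (positive⁻¹ 1ℚ) (proj₁ (proj₂ Γ))

    γ>0 : 0ℚ < γ
    γ>0 = <-≤-trans (ℕ→ℚ>0 {4} (ℕ.s≤s ℕ.z≤n)) 4≤γ

    2γ>1 : 1ℚ < ℕ→ℚ 2 * γ
    2γ>1 = <-≤-trans (ℕ→ℚ-mono-< {1} {8} (ℕ.s≤s (ℕ.s≤s ℕ.z≤n)))
                     (*-monoˡ-≤-nonNeg (ℕ→ℚ 2) {{nonNegative (0≤ℕ→ℚ 2)}} 4≤γ)

    2γ>0 : 0ℚ < ℕ→ℚ 2 * γ
    2γ>0 = <-trans (positive⁻¹ 1ℚ) 2γ>1

    z*2γ≡1 : z * (ℕ→ℚ 2 * γ) ≡ 1ℚ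
    z*2γ≡1 = [p⊘q]*q≡p 1ℚ (ℕ→ℚ 2 * γ) (q>0⇒q≢0 2γ>0)

    z>0 : 0ℚ < z
    z>0 = p⊘q>0 (positive⁻¹ 1ℚ) 2γ>0

    z<1 : z < 1ℚ
    z<1 = *-cancelʳ-<-nonNeg (ℕ→ℚ 2 * γ) {{nonNegative (<⇒≤ 2γ>0)}}
            (subst₂ _<_ (≡-sym z*2γ≡1) (≡-sym (*-identityˡ (ℕ→ℚ 2 * γ))) 2γ>1)

    l>0 : 0ℚ < ℕ→ℚ l
    l>0 = ℕ→ℚ>0 (ℕ.≤-trans 1≤m m≤l)

    b>0 : 0ℚ < b
    b>0 = p⊘q>0 (p*q>0 (p*q>0 (p*q>0 (ℕ→ℚ>0 {14} (ℕ.s≤s ℕ.z≤n)) γ>0) (ℕ→ℚ>0 (ℕ.≤-trans 1≤m (ℕ.≤-trans m≤l l≤n))))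
                         (ℕ→ℚ>0 1≤m)) l>0

    -- Since 2nm ≤ 7nm, the ratio 2nm / (l b) of containing-pair-bound is at most z.
    l*[b*z]≡7nm : ℕ→ℚ l * (b * z) ≡ ℕ→ℚ (7 ℕ.* n ℕ.* m)
    l*[b*z]≡7nm = begin
      ℕ→ℚ l * (b * z)                                    ≡⟨ regroup₁ (ℕ→ℚ l) b z ⟩
      b * ℕ→ℚ l * z                                      ≡⟨ cong (_* z) ([p⊘q]*q≡p _ (ℕ→ℚ l) (q>0⇒q≢0 l>0)) ⟩
      ℕ→ℚ 14 * γ * ℕ→ℚ n * ℕ→ℚ m * z                     ≡⟨ cong (λ c → c * γ * ℕ→ℚ n * ℕ→ℚ m * z) (ℕ→ℚ-* 7 2) ⟩
      ℕ→ℚ 7 * ℕ→ℚ 2 * γ * ℕ→ℚ n * ℕ→ℚ m * z              ≡⟨ regroup₂ (ℕ→ℚ 7) (ℕ→ℚ 2) γ (ℕ→ℚ n) (ℕ→ℚ m) z ⟩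
      ℕ→ℚ 7 * ℕ→ℚ n * ℕ→ℚ m * (z * (ℕ→ℚ 2 * γ))         ≡⟨ cong (ℕ→ℚ 7 * ℕ→ℚ n * ℕ→ℚ m *_) z*2γ≡1 ⟩
      ℕ→ℚ 7 * ℕ→ℚ n * ℕ→ℚ m * 1ℚ                         ≡⟨ *-identityʳ _ ⟩
      ℕ→ℚ 7 * ℕ→ℚ n * ℕ→ℚ m                              ≡⟨ trans (ℕ→ℚ-* (7 ℕ.* n) m) (cong (_* ℕ→ℚ m) (ℕ→ℚ-* 7 n)) ⟨
      ℕ→ℚ (7 ℕ.* n ℕ.* m)                                ∎
      where
      open ≡-Reasoning
      regroup₁ : ∀ l b z → l * (b * z) ≡ b * l * z
      regroup₁ = solve 3 (λ l b z → l :* (b :* z) := b :* l :* z) refl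
      regroup₂ : ∀ s t g n m z → s * t * g * n * m * z ≡ s * n * m * (z * (t * g))
      regroup₂ = solve 6 (λ s t g n m z → s :* t :* g :* n :* m :* z := s :* n :* m :* (z :* (t :* g))) refl

    containing-pair-bound-ℚ : ∀ j → j ℕ.≤ m → ℕ→ℚ ((m C j) ℕ.* containing (m ℕ.+ m ∸ j) ℕ.* CC) ≤ (b * z) ^ℚ j * K
    containing-pair-bound-ℚ j j≤m = *-cancelʳ-≤-pos (ℕ→ℚ l ^ℚ j) {{positive (^ℚ>0 j l>0)}} (begin
      ℕ→ℚ P * ℕ→ℚ l ^ℚ j                    ≡⟨ trans (ℕ→ℚ-* P (l ℕ.^ j)) (cong (ℕ→ℚ P *_) (ℕ→ℚ-^ l j)) ⟨
      ℕ→ℚ (P ℕ.* l ℕ.^ j)                   ≤⟨ ℕ→ℚ-mono-≤ (containing-pair-bound m j j≤m 4m≤l) ⟩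
      ℕ→ℚ ((2 ℕ.* n ℕ.* m) ℕ.^ j ℕ.* Kℕ)    ≤⟨ ℕ→ℚ-mono-≤ (ℕ.*-monoˡ-≤ Kℕ (ℕ.^-monoˡ-≤ j 2nm≤7nm)) ⟩
      ℕ→ℚ ((7 ℕ.* n ℕ.* m) ℕ.^ j ℕ.* Kℕ)    ≡⟨ trans (ℕ→ℚ-* ((7 ℕ.* n ℕ.* m) ℕ.^ j) Kℕ) (cong (_* K) (ℕ→ℚ-^ (7 ℕ.* n ℕ.* m) j)) ⟩
      ℕ→ℚ (7 ℕ.* n ℕ.* m) ^ℚ j * K          ≡⟨ cong (λ x → x ^ℚ j * K) l*[b*z]≡7nm ⟨
      (ℕ→ℚ l * (b * z)) ^ℚ j * K            ≡⟨ cong (_* K) (^ℚ-distrib-* (ℕ→ℚ l) (b * z) j) ⟩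
      ℕ→ℚ l ^ℚ j * (b * z) ^ℚ j * K         ≡⟨ rotate (ℕ→ℚ l ^ℚ j) ((b * z) ^ℚ j) K ⟩
      (b * z) ^ℚ j * K * ℕ→ℚ l ^ℚ j         ∎)
      where
      open ≤-Reasoning
      P = (m C j) ℕ.* containing (m ℕ.+ m ∸ j) ℕ.* CC
      Kℕ = (n C l) ℕ.* ((l C m) ℕ.* (l C m))
      2nm≤7nm : 2 ℕ.* n ℕ.* m ℕ.≤ 7 ℕ.* n ℕ.* m
      2nm≤7nm = ℕ.*-monoˡ-≤ m (ℕ.*-monoˡ-≤ n (ℕ.m≤m+n 2 5))
      rotate : ∀ a c k → a * c * k ≡ c * k * a
      rotate = solve 3 (λ a c k → a :* c :* k := c :* k :* a) refl

    level-bound : ∀ j → j ℕ.≤ m →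
                  ℕ→ℚ (weightAt w F j ℕ.* containing (m ℕ.+ m ∸ j) ℕ.* CC) ≤ h * W * K * z ^ℚ j
    level-bound j j≤m = begin
      ℕ→ℚ (Wj ℕ.* Aj ℕ.* CC)                           ≡⟨ trans (cong ℕ→ℚ (ℕ.*-assoc Wj Aj CC)) (ℕ→ℚ-* Wj (Aj ℕ.* CC)) ⟩
      ℕ→ℚ Wj * ℕ→ℚ (Aj ℕ.* CC)                         ≤⟨ *-monoʳ-≤-nonNeg (ℕ→ℚ (Aj ℕ.* CC)) {{nonNegative (0≤ℕ→ℚ (Aj ℕ.* CC))}} (weightAt-bound {w = w} {F} Γ j j≤m) ⟩
      h * ib * ℕ→ℚ (m C j) * W * ℕ→ℚ (Aj ℕ.* CC)       ≡⟨ regroup₁ h ib (ℕ→ℚ (m C j)) W (ℕ→ℚ (Aj ℕ.* CC)) ⟩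
      h * W * ib * (ℕ→ℚ (m C j) * ℕ→ℚ (Aj ℕ.* CC))     ≡⟨ cong (h * W * ib *_) (trans (cong ℕ→ℚ (ℕ.*-assoc (m C j) Aj CC)) (ℕ→ℚ-* (m C j) (Aj ℕ.* CC))) ⟨
      h * W * ib * ℕ→ℚ ((m C j) ℕ.* Aj ℕ.* CC)         ≤⟨ *-monoˡ-≤-nonNeg (h * W * ib) {{nonNegative hWib≥0}} (containing-pair-bound-ℚ j j≤m) ⟩
      h * W * ib * ((b * z) ^ℚ j * K)                  ≡⟨ cong (λ x → h * W * ib * (x * K)) (^ℚ-distrib-* b z j) ⟩
      h * W * ib * (b ^ℚ j * z ^ℚ j * K)               ≡⟨ regroup₂ h W ib (b ^ℚ j) (z ^ℚ j) K ⟩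
      h * W * K * z ^ℚ j * (ib * b ^ℚ j)               ≡⟨ cong (h * W * K * z ^ℚ j *_) ([p⊘q]*q≡p 1ℚ (b ^ℚ j) (q>0⇒q≢0 (^ℚ>0 j b>0))) ⟩
      h * W * K * z ^ℚ j * 1ℚ                          ≡⟨ *-identityʳ _ ⟩
      h * W * K * z ^ℚ j                               ∎
      where
      open ≤-Reasoning
      Wj = weightAt w F j
      Aj = containing (m ℕ.+ m ∸ j)
      ib = 1ℚ ⊘ b ^ℚ j
      hWib≥0 : 0ℚ ≤ h * W * ib
      hWib≥0 = p*q≥0 (p*q≥0 (<⇒≤ h>0) (0≤ℕ→ℚ (totalWeight w F)))
                     (<⇒≤ (p⊘q>0 (positive⁻¹ 1ℚ) (^ℚ>0 j b>0)))
      regroup₁ : ∀ h i c w a → h * i * c * w * a ≡ h * w * i * (c * a)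
      regroup₁ = solve 5 (λ h i c w a → h :* i :* c :* w :* a := h :* w :* i :* (c :* a)) refl
      regroup₂ : ∀ h w i p q k → h * w * i * (p * q * k) ≡ h * w * k * q * (i * p)
      regroup₂ = solve 6 (λ h w i p q k → h :* w :* i :* (p :* q :* k) := h :* w :* k :* q :* (i :* p)) refl

    L : List (Subset n)
    L = subsetsOfSize n l

    T : ℕ
    T = ∑[ Y ∈ L ] totalWeight w (restrict F Y)

    hWK≥0 : 0ℚ ≤ h * W * K
    hWK≥0 = p*q≥0 (p*q≥0 (<⇒≤ h>0) (0≤ℕ→ℚ (totalWeight w F))) (0≤ℕ→ℚ ((n C l) ℕ.* ((l C m) ℕ.* (l C m))))

    T*CC*[1-z]≤hWK : ℕ→ℚ (T ℕ.* CC) * (1ℚ - z) ≤ h * W * K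
    T*CC*[1-z]≤hWK = begin
      ℕ→ℚ (T ℕ.* CC) * (1ℚ - z)
        ≡⟨ cong (λ t → ℕ→ℚ t * (1ℚ - z)) T*CC≡∑ ⟩
      ℕ→ℚ (∑[ j ∈ upTo (suc m) ] term j) * (1ℚ - z)
        ≤⟨ geometric-bound (suc m) term {h * W * K} (<⇒≤ z<1) (λ j j<1+m → level-bound j (ℕ.≤-pred j<1+m)) ⟩
      h * W * K * (1ℚ - z ^ℚ suc m)
        ≤⟨ *-monoˡ-≤-nonNeg (h * W * K) {{nonNegative hWK≥0}} (p-q≤p 1ℚ (^ℚ≥0 (suc m) (<⇒≤ z>0))) ⟩
      h * W * K * 1ℚ
        ≡⟨ *-identityʳ (h * W * K) ⟩
      h * W * K  ∎
      where
      open ≤-Reasoning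
      term : ℕ → ℕ
      term j = weightAt w F j ℕ.* containing (m ℕ.+ m ∸ j) ℕ.* CC
      T*CC≡∑ : T ℕ.* CC ≡ ∑[ j ∈ upTo (suc m) ] term j
      T*CC≡∑ = trans (cong (ℕ._* CC) (first-moment w (ℕ.≤-trans (ℕ.m≤m+n (m ℕ.+ m) (m ℕ.+ m)) 4m≤l) l≤n F sizes))
                     (≡-sym (∑-*ʳ (upTo (suc m)) (λ j → weightAt w F j ℕ.* containing (m ℕ.+ m ∸ j)) CC))

    D bound : ℚ
    D = ε * (1ℚ - z) * ℕ→ℚ (n C m) * ℕ→ℚ (n C m)
    bound = (h * ℕ→ℚ (l C m) * ℕ→ℚ (l C m)) ⊘ D * W

    D>0 : 0ℚ < D
    D>0 = p*q>0 (p*q>0 (p*q>0 ε>0 (p<q⇒0<q-p z<1)) nCm>0) nCm>0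
      where
      nCm>0 = ℕ→ℚ>0 (nCk>0 (ℕ.≤-trans m≤l l≤n))

    bound>0 : 0ℚ < bound
    bound>0 = p*q>0 (p⊘q>0 (p*q>0 (p*q>0 h>0 lCm>0) lCm>0) D>0) (ℕ→ℚ>0 (proj₁ (proj₂ (proj₂ Γ))))
      where
      lCm>0 = ℕ→ℚ>0 (nCk>0 m≤l)

    T≤ε*|L|*bound : ℕ→ℚ T ≤ ε * ℕ→ℚ (length L) * bound
    T≤ε*|L|*bound = *-cancelʳ-≤-pos D {{positive D>0}} (begin
      ℕ→ℚ T * D                                    ≡⟨ regroup₁ ε (1ℚ - z) (ℕ→ℚ T) Cnm ⟩
      ε * (ℕ→ℚ T * (Cnm * Cnm) * (1ℚ - z))         ≡⟨ cong (λ c → ε * (c * (1ℚ - z))) ℕ→ℚ[T*CC] ⟨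
      ε * (ℕ→ℚ (T ℕ.* CC) * (1ℚ - z))              ≤⟨ *-monoˡ-≤-nonNeg ε {{nonNegative (<⇒≤ ε>0)}} T*CC*[1-z]≤hWK ⟩
      ε * (h * W * K)                              ≡⟨ cong (λ k → ε * (h * W * k)) K≡ ⟩
      ε * (h * W * (Cnl * (Clm * Clm)))            ≡⟨ regroup₂ ε h W Cnl Clm ⟩
      ε * Cnl * (H * W)                            ≡⟨ cong (λ x → ε * Cnl * (x * W)) ([p⊘q]*q≡p H D (q>0⇒q≢0 D>0)) ⟨
      ε * Cnl * (H ⊘ D * D * W)                    ≡⟨ regroup₃ (ε * Cnl) (H ⊘ D) D W ⟩
      ε * Cnl * bound * D                          ≡⟨ cong (λ k → ε * ℕ→ℚ k * bound * D) (length-subsetsOfSize n l) ⟨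
      ε * ℕ→ℚ (length L) * bound * D               ∎)
      where
      open ≤-Reasoning
      Cnm = ℕ→ℚ (n C m)
      Cnl = ℕ→ℚ (n C l)
      Clm = ℕ→ℚ (l C m)
      H = h * Clm * Clm
      ℕ→ℚ[T*CC] : ℕ→ℚ (T ℕ.* CC) ≡ ℕ→ℚ T * (Cnm * Cnm)
      ℕ→ℚ[T*CC] = trans (ℕ→ℚ-* T CC) (cong (ℕ→ℚ T *_) (ℕ→ℚ-* (n C m) (n C m)))
      K≡ : K ≡ Cnl * (Clm * Clm)
      K≡ = trans (ℕ→ℚ-* (n C l) _) (cong (Cnl *_) (ℕ→ℚ-* (l C m) (l C m)))
      regroup₁ : ∀ e u t c → t * (e * u * c * c) ≡ e * (t * (c * c) * u)
      regroup₁ = solve 4 (λ e u t c → t :* (e :* u :* c :* c) := e :* (t :* (c :* c) :* u)) refl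
      regroup₂ : ∀ e h w c a → e * (h * w * (c * (a * a))) ≡ e * c * (h * a * a * w)
      regroup₂ = solve 5 (λ e h w c a → e :* (h :* w :* (c :* (a :* a))) := e :* c :* (h :* a :* a :* w)) refl
      regroup₃ : ∀ x q d w → x * (q * d * w) ≡ x * (q * w) * d
      regroup₃ = solve 4 (λ x q d w → x :* (q :* d :* w) := x :* (q :* w) :* d) refl

    [1-ε]*nCl≤countGood : (1ℚ - ε) * ℕ→ℚ (n C l) ≤ ℕ→ℚ (countGood n l w F bound)
    [1-ε]*nCl≤countGood = subst (λ k → (1ℚ - ε) * ℕ→ℚ k ≤ ℕ→ℚ (countGood n l w F bound)) (length-subsetsOfSize n l)
      (markov (λ Y → totalWeight w (restrict F Y)) bound {ε} L bound>0 T≤ε*|L|*bound)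

open import Defs
open import Data.Nat using (ℕ)
open import Data.Nat.Combinatorics using (_C_)
open import Data.Integer using (+_)
open import Data.Rational using (ℚ; 0ℚ; 1ℚ; _+_; _*_; _-_; _≤_; _<_; ceiling)
open import Data.Fin.Subset using (Subset)
open import Data.List using (List)
open import Data.Product using (Σ; _×_)
open import Data.Product using (_,_)
import Data.Nat as ℕ
open RationalArithmetic using (ℕ→ℚ-mono-<; ceiling≤)

corollary2p8 : Σ ℚ (λ γ₀ → (0ℚ < γ₀) ×
  ((n m l : ℕ) → (γ : ℚ) → (F : List (Subset n)) → (w : Weight n) → (h : ℚ) →
    1 Data.Nat.≤ m → m Data.Nat.≤ n → m Data.Nat.< l → l Data.Nat.≤ n →
    γ₀ ≤ γ → γ ≤ ℕ→ℚ l ⊘ ℕ→ℚ (m Data.Nat.* m) → γ ≤ ℕ→ℚ (n C l) →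
    IsFamily m F →
    Gamma m w F ((ℕ→ℚ 14 * γ * ℕ→ℚ n * ℕ→ℚ m) ⊘ ℕ→ℚ l) h →
    (ε : ℚ) → 0ℚ < ε → ε < 1ℚ →
    Data.Integer._≤_ (ceiling ((1ℚ - ε) * ℕ→ℚ (n C l)))
      (+ countGood n l w F
           ((h * ℕ→ℚ (l C m) * ℕ→ℚ (l C m))
             ⊘ (ε * (1ℚ - (1ℚ ⊘ (ℕ→ℚ 2 * γ))) * ℕ→ℚ (n C m) * ℕ→ℚ (n C m))
             * ℕ→ℚ (totalWeight w F)))))
corollary2p8 = ℕ→ℚ 4 , ℕ→ℚ-mono-< {0} {4} (ℕ.s≤s ℕ.z≤n) ,
  λ n m l γ F w h 1≤m _ _ l≤n 4≤γ γ≤l/m² _ (_ , sizes) Γ ε ε>0 _ →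
    ceiling≤ _ _ (Estimate.Bound.[1-ε]*nCl≤countGood 1≤m l≤n 4≤γ γ≤l/m² sizes Γ ε>0)
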